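{- (Substitution.) Let $\phi$ be a set of index variables, $\Phi$ a finite set of constraints on $\phi$, $\Gamma$ a context, $v$ a variable, $T$ a sized type, $e$ an expression with $\phi;\Phi;\Gamma\vdash e:T$. (1) If $\phi;\Phi;\Gamma,v:T\vdash e':U$ then $\phi;\Phi;\Gamma\vdash e'[v:=e]:U$. (2) If $\phi;\Phi;\Gamma,v:T\vdash P\triangleleft K$ then $\phi;\Phi;\Gamma\vdash P[v:=e]\triangleleft K$.
   Context: Processes. Base variables $x,y,z,\dots$ and channel names $a,b,c,\dots$; $v$ ranges over both. Expressions: $e ::= v \mid \mathtt{0} \mid \mathtt{s}(e) \mid [\,] \mid e::e' \mid \mathtt{tt} \mid \mathtt{ff}$. Processes: $P,Q ::= 0 \mid P\mid Q \mid\ !a(\vec v).P \mid a(\vec v).P \mid \overline{a}\langle \vec e\rangle \mid (\nu a)P \mid \mathtt{match}\ e\ \{\mathtt{0}\mapsto P;\ \mathtt{s}(x)\mapsto Q\} \mid \mathtt{match}\ e\ \{[\,]\mapsto P;\ x::y\mapsto Q\} \mid \mathtt{if}\ e\ \mathtt{then}\ P\ \mathtt{else}\ Q \mid \mathtt{tick}.P$, up to $\alpha$-renaming; $P[v:=e]$ is capture-avoiding substitution. Indices: $I,J,K ::= i \mid f(I_1,\dots,I_n)$, function symbols interpreted as functions $\mathbb N^n\to\mathbb N$ (including $+$, $\cdot$, truncated subtraction). Constraints $I\bowtie J$, $\bowtie\in\{\le,<,=,\ne\}$; $\phi;\Phi\vDash C$ means every valuation satisfying $\Phi$ satisfies $C$.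 Sized types: $\mathcal B ::= \mathsf{Nat}[I,J]\mid\mathsf{List}[I,J](\mathcal B)\mid\mathsf{Bool}$; $T ::= \mathcal B\mid\mathsf{ch}_I(\vec T)\mid\mathsf{in}_I(\vec T)\mid\mathsf{out}_I(\vec T)\mid\mathsf{serv}_I^{\forall\vec i.K}(\vec T)\mid\mathsf{iserv}_I^{\forall\vec i.K}(\vec T)\mid\mathsf{oserv}_I^{\forall\vec i.K}(\vec T)$. Subtyping $\phi;\Phi\vdash T\sqsubseteq U$: $\mathsf{Nat}[I,J]\sqsubseteq\mathsf{Nat}[I',J']$ if $\phi;\Phi\vDash I'\le I$ and $J\le J'$; $\mathsf{List}[I,J](\mathcal B)\sqsubseteq\mathsf{List}[I',J'](\mathcal B')$ if moreover $\mathcal B\sqsubseteq\mathcal B'$; $\mathsf{Bool}\sqsubseteq\mathsf{Bool}$; $\mathsf{ch}_I(\vec T)\sqsubseteq\mathsf{ch}_J(\vec U)$ if $\phi;\Phi\vDash I=J$, $\vec T\sqsubseteq\vec U$, $\vec U\sqsubseteq\vec T$; $\mathsf{ch}_I(\vec T)\sqsubseteq\mathsf{in}_I(\vec T)$, $\mathsf{ch}_I(\vec T)\sqsubseteq\mathsf{out}_I(\vec T)$; $\mathsf{in}_I(\vec T)\sqsubseteq\mathsf{in}_J(\vec U)$ if $I=J$, $\vec T\sqsubseteq\vec U$; $\mathsf{out}_I(\vec T)\sqsubseteq\mathsf{out}_J(\vec U)$ if $I=J$, $\vec U\sqsubseteq\vec T$; $\mathsf{serv}_I^{\forall\vec i.K}(\vec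 T)\sqsubseteq\mathsf{serv}_J^{\forall\vec i.K'}(\vec U)$ if $I=J$, $(\phi,\vec i);\Phi\vdash\vec T\sqsubseteq\vec U$ and $\vec U\sqsubseteq\vec T$, $(\phi,\vec i);\Phi\vDash K=K'$; $\mathsf{serv}_I^{\forall\vec i.K}(\vec T)\sqsubseteq\mathsf{iserv}_I^{\forall\vec i.K}(\vec T)$ and $\sqsubseteq\mathsf{oserv}_I^{\forall\vec i.K}(\vec T)$; $\mathsf{iserv}_I^{\forall\vec i.K}(\vec T)\sqsubseteq\mathsf{iserv}_J^{\forall\vec i.K'}(\vec U)$ if $I=J$, $(\phi,\vec i);\Phi\vdash\vec T\sqsubseteq\vec U$, $(\phi,\vec i);\Phi\vDash K'\le K$; $\mathsf{oserv}_I^{\forall\vec i.K}(\vec T)\sqsubseteq\mathsf{oserv}_J^{\forall\vec i.K'}(\vec U)$ if $I=J$, $(\phi,\vec i);\Phi\vdash\vec U\sqsubseteq\vec T$, $(\phi,\vec i);\Phi\vDash K\le K'$; transitivity. Contexts: pointwise. Advancing time $T^{ -I}$: $\mathcal B^{ -I}=\mathcal B$; for $\chi\in\{\mathsf{ch},\mathsf{in},\mathsf{out},\mathsf{iserv}\}$, $\chi_J(\dots)^{ -I}=\chi_{J-I}(\dots)$ if $\phi;\Phi\vDash J\ge I$, undefined otherwise; $\mathsf{serv}_J^{\forall\vec i.K}(\vec T)^{ -I}$ is $\mathsf{serv}_{J-I}^{\forall\vec i.K}(\vec T)$ if $\phi;\Phi\vDash J\ge I$ and $\mathsf{oserv}_{J-I}^{\forall\vec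 i.K}(\vec T)$ otherwise; $\mathsf{oserv}_J^{\forall\vec i.K}(\vec T)^{ -I}=\mathsf{oserv}_{J-I}^{\forall\vec i.K}(\vec T)$. $\Gamma^{ -I}$: apply to each hypothesis, deleting undefined ones. $\Gamma$ is time invariant if each hypothesis has base type or type $\mathsf{oserv}_I^{\forall\vec i.K}(\vec T)$ with $\phi;\Phi\vDash I=0$. Expression typing $\phi;\Phi;\Gamma\vdash e:T$: variables from $\Gamma$; $\mathtt0:\mathsf{Nat}[0,0]$; $\mathtt s(e):\mathsf{Nat}[I+1,J+1]$ from $e:\mathsf{Nat}[I,J]$; $[\,]:\mathsf{List}[0,0](\mathcal B)$; $e::e':\mathsf{List}[I+1,J+1](\mathcal B)$ from $e:\mathcal B$, $e':\mathsf{List}[I,J](\mathcal B)$; $\mathtt{tt},\mathtt{ff}:\mathsf{Bool}$; subsumption from $\Delta\vdash e:U$, $\Gamma\sqsubseteq\Delta$, $U\sqsubseteq T$. Process typing $\phi;\Phi;\Gamma\vdash P\triangleleft K$: $0\triangleleft0$; $P\mid Q\triangleleft K$ from $P\triangleleft K$, $Q\triangleleft K$; $\phi;\Phi;\Gamma,\Delta\vdash\ !a(\vec v).P\triangleleft I$ from $\phi;\Phi;\Gamma,\Delta\vdash a:\mathsf{iserv}_I^{\forall\vec i.K}(\vec T)$, $(\phi,\vec i);\Phi;\Gamma',\vec v:\vec T\vdash P\triangleleft K$, $\Gamma'$ time invariant, $\phi;\Phi\vdash\Gamma^{ -I}\sqsubseteq\Gamma'$; $a(\vec v).P\triangleleft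 K+I$ from $\Gamma\vdash a:\mathsf{in}_I(\vec T)$, $\Gamma^{ -I},\vec v:\vec T\vdash P\triangleleft K$; $\overline a\langle\vec e\rangle\triangleleft I$ from $\Gamma\vdash a:\mathsf{out}_I(\vec T)$, $\Gamma^{ -I}\vdash\vec e:\vec T$; $\overline a\langle\vec e\rangle\triangleleft I+K[\vec i:=\vec J]$ from $\Gamma\vdash a:\mathsf{oserv}_I^{\forall\vec i.K}(\vec T)$, $\Gamma^{ -I}\vdash\vec e:\vec T[\vec i:=\vec J]$; $(\nu a)P\triangleleft K$ from $\Gamma,a:T\vdash P\triangleleft K$; match on naturals $\triangleleft K$ from $\Gamma\vdash e:\mathsf{Nat}[I,J]$, $\phi;(\Phi,I\le0);\Gamma\vdash P\triangleleft K$, $\phi;(\Phi,J\ge1);\Gamma,x:\mathsf{Nat}[I-1,J-1]\vdash Q\triangleleft K$; match on lists $\triangleleft K$ from $\Gamma\vdash e:\mathsf{List}[I,J](\mathcal B)$, $\phi;(\Phi,I\le0);\Gamma\vdash P\triangleleft K$, $\phi;(\Phi,J\ge1);\Gamma,x:\mathcal B,y:\mathsf{List}[I-1,J-1](\mathcal B)\vdash Q\triangleleft K$; $\mathtt{if}$ $\triangleleft K$ from $e:\mathsf{Bool}$, $P\triangleleft K$, $Q\triangleleft K$; $\Gamma\vdash\mathtt{tick}.P\triangleleft K+1$ from $\Gamma^{ -1}\vdash P\triangleleft K$; subsumption: $\phi;\Phi;\Gamma\vdash P\triangleleft K'$ from $\phi;\Phi;\Delta\vdash P\triangleleft K$, $\phi;\Phi\vdash\Gamma\sqsubseteq\Delta$,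 $\phi;\Phi\vDash K\le K'$. -}

module Defs where

open import Data.Nat as ℕ using (ℕ; zero; suc; _+_; _∸_; _*_)
open import Data.Fin using (Fin; zero; suc; _↑ˡ_; _↑ʳ_; splitAt)
open import Data.Vec as Vec using (Vec; []; _∷_; _++_; lookup)
open import Data.List as List using (List; []; _∷_; length)
open import Data.List.Relation.Unary.All using (All)
open import Data.List.Relation.Binary.Pointwise using (Pointwise)
open import Data.Vec.Relation.Binary.Pointwise.Inductive using ()
  renaming (Pointwise to VPointwise)
import Data.Vec.Relation.Unary.All as VAll
open import Data.Maybe using (Maybe; just; nothing)
open import Data.Sum using (_⊎_; inj₁; inj₂)
open import Relation.Binary.PropositionalEquality using (_≡_)
open import Relation.Nullary using (¬_)

-- Index terms over φ index variables (de Bruijn: Fin φ).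
-- A function symbol of arity k is given together with its
-- interpretation ℕ^k → ℕ.

data Idx (φ : ℕ) : Set where
  ivar : Fin φ → Idx φ
  fn   : (k : ℕ) → (Vec ℕ k → ℕ) → Vec (Idx φ) k → Idx φ

Val : ℕ → Set
Val φ = Fin φ → ℕ

mutual
  ⟦_⟧ : ∀ {φ} → Idx φ → Val φ → ℕ
  ⟦ ivar i ⟧ ρ = ρ i
  ⟦ fn k f Is ⟧ ρ = f (⟦ Is ⟧* ρ)

  ⟦_⟧* : ∀ {φ k} → Vec (Idx φ) k → Val φ → Vec ℕ k
  ⟦ [] ⟧* ρ = []
  ⟦ I ∷ Is ⟧* ρ = ⟦ I ⟧ ρ ∷ ⟦ Is ⟧* ρ

-- constants and the usual binary symbols (truncated subtraction)
infix 9 ‵_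
‵_ : ∀ {φ} → ℕ → Idx φ
‵ n = fn 0 (λ _ → n) []

bin : ∀ {φ} → (ℕ → ℕ → ℕ) → Idx φ → Idx φ → Idx φ
bin f I J = fn 2 (λ v → f (Vec.head v) (Vec.head (Vec.tail v))) (I ∷ J ∷ [])

infixl 6 _⊕_ _⊖_
infixl 7 _⊗_
_⊕_ _⊖_ _⊗_ : ∀ {φ} → Idx φ → Idx φ → Idx φ
_⊕_ = bin _+_
_⊖_ = bin _∸_
_⊗_ = bin _*_

mutual
  isub : ∀ {φ ψ} → (Fin φ → Idx ψ) → Idx φ → Idx ψ
  isub σ (ivar i) = σ i
  isub σ (fn k f Is) = fn k f (isub* σ Is)

  isub* : ∀ {φ ψ k} → (Fin φ → Idx ψ) → Vec (Idx φ) k → Vec (Idx ψ) k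
  isub* σ [] = []
  isub* σ (I ∷ Is) = isub σ I ∷ isub* σ Is

-- weakening by m fresh index variables (the fresh ones come first)
iwkσ : ∀ {φ} m → Fin φ → Idx (m + φ)
iwkσ m i = ivar (m ↑ʳ i)

ilift : ∀ {φ ψ} m → (Fin φ → Idx ψ) → Fin (m + φ) → Idx (m + ψ)
ilift {ψ = ψ} m σ x with splitAt m x
... | inj₁ j = ivar (j ↑ˡ ψ)
... | inj₂ i = isub (iwkσ m) (σ i)

inst : ∀ {φ m} → Vec (Idx φ) m → Fin (m + φ) → Idx φ
inst {m = m} Js x with splitAt m x
... | inj₁ j = lookup Js j
... | inj₂ i = ivar i

infix 4 _≤c_ _<c_ _=c_ _≠c_
data Cstr (φ : ℕ) : Set where
  _≤c_ _<c_ _=c_ _≠c_ : Idx φ → Idx φ → Cstr φ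

sat : ∀ {φ} → Val φ → Cstr φ → Set
sat ρ (I ≤c J) = ⟦ I ⟧ ρ ℕ.≤ ⟦ J ⟧ ρ
sat ρ (I <c J) = ⟦ I ⟧ ρ ℕ.< ⟦ J ⟧ ρ
sat ρ (I =c J) = ⟦ I ⟧ ρ ≡ ⟦ J ⟧ ρ
sat ρ (I ≠c J) = ¬ (⟦ I ⟧ ρ ≡ ⟦ J ⟧ ρ)

csub : ∀ {φ ψ} → (Fin φ → Idx ψ) → Cstr φ → Cstr ψ
csub σ (I ≤c J) = isub σ I ≤c isub σ J
csub σ (I <c J) = isub σ I <c isub σ J
csub σ (I =c J) = isub σ I =c isub σ J
csub σ (I ≠c J) = isub σ I ≠c isub σ J

cwk : ∀ {φ} m → List (Cstr φ) → List (Cstr (m + φ))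
cwk m Φ = List.map (csub (iwkσ m)) Φ

infix 4 _⊨_
_⊨_ : ∀ {φ} → List (Cstr φ) → Cstr φ → Set
_⊨_ {φ} Φ C = (ρ : Val φ) → All (sat ρ) Φ → sat ρ C

data BType (φ : ℕ) : Set where
  Nat  : Idx φ → Idx φ → BType φ
  Lst  : Idx φ → Idx φ → BType φ → BType φ
  Bool : BType φ

-- serv/iserv/oserv  I  m  K  T̃  stands for  serv_I^{∀ i₁…i_m. K}(T̃),
-- K and T̃ living over the m bound index variables plus φ.
data Type (φ : ℕ) : Set where
  base : BType φ → Type φ
  ch inT outT : Idx φ → List (Type φ) → Type φ
  serv iserv oserv : Idx φ → (m : ℕ) → Idx (m + φ) → List (Type (m + φ)) → Type φ

bsub : ∀ {φ ψ} → (Fin φ → Idx ψ) → BType φ → BType ψ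
bsub σ (Nat I J) = Nat (isub σ I) (isub σ J)
bsub σ (Lst I J B) = Lst (isub σ I) (isub σ J) (bsub σ B)
bsub σ Bool = Bool

mutual
  tsub : ∀ {φ ψ} → (Fin φ → Idx ψ) → Type φ → Type ψ
  tsub σ (base B) = base (bsub σ B)
  tsub σ (ch I Ts) = ch (isub σ I) (tsub* σ Ts)
  tsub σ (inT I Ts) = inT (isub σ I) (tsub* σ Ts)
  tsub σ (outT I Ts) = outT (isub σ I) (tsub* σ Ts)
  tsub σ (serv I m K Ts) = serv (isub σ I) m (isub (ilift m σ) K) (tsub* (ilift m σ) Ts)
  tsub σ (iserv I m K Ts) = iserv (isub σ I) m (isub (ilift m σ) K) (tsub* (ilift m σ) Ts)
  tsub σ (oserv I m K Ts) = oserv (isub σ I) m (isub (ilift m σ) K) (tsub* (ilift m σ) Ts)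

  tsub* : ∀ {φ ψ} → (Fin φ → Idx ψ) → List (Type φ) → List (Type ψ)
  tsub* σ [] = []
  tsub* σ (T ∷ Ts) = tsub σ T ∷ tsub* σ Ts

infix 4 _⊢ᵇ_⊑_ _⊢_⊑_

data _⊢ᵇ_⊑_ {φ} (Φ : List (Cstr φ)) : BType φ → BType φ → Set where
  sNat  : ∀ {I J I' J'} → Φ ⊨ (I' ≤c I) → Φ ⊨ (J ≤c J') →
          Φ ⊢ᵇ Nat I J ⊑ Nat I' J'
  sLst  : ∀ {I J I' J' B B'} → Φ ⊨ (I' ≤c I) → Φ ⊨ (J ≤c J') →
          Φ ⊢ᵇ B ⊑ B' → Φ ⊢ᵇ Lst I J B ⊑ Lst I' J' B'
  sBool : Φ ⊢ᵇ Bool ⊑ Bool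
  sTransᵇ : ∀ {A B C} → Φ ⊢ᵇ A ⊑ B → Φ ⊢ᵇ B ⊑ C → Φ ⊢ᵇ A ⊑ C

data _⊢_⊑_ : ∀ {φ} → List (Cstr φ) → Type φ → Type φ → Set where
  sBase  : ∀ {φ} {Φ : List (Cstr φ)} {B B'} → Φ ⊢ᵇ B ⊑ B' → Φ ⊢ base B ⊑ base B'
  sCh    : ∀ {φ} {Φ : List (Cstr φ)} {I J Ts Us} → Φ ⊨ (I =c J) →
           Pointwise (Φ ⊢_⊑_) Ts Us → Pointwise (Φ ⊢_⊑_) Us Ts →
           Φ ⊢ ch I Ts ⊑ ch J Us
  sChIn  : ∀ {φ} {Φ : List (Cstr φ)} {I Ts} → Φ ⊢ ch I Ts ⊑ inT I Ts
  sChOut : ∀ {φ} {Φ : List (Cstr φ)} {I Ts} → Φ ⊢ ch I Ts ⊑ outT I Ts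
  sIn    : ∀ {φ} {Φ : List (Cstr φ)} {I J Ts Us} → Φ ⊨ (I =c J) →
           Pointwise (Φ ⊢_⊑_) Ts Us → Φ ⊢ inT I Ts ⊑ inT J Us
  sOut   : ∀ {φ} {Φ : List (Cstr φ)} {I J Ts Us} → Φ ⊨ (I =c J) →
           Pointwise (Φ ⊢_⊑_) Us Ts → Φ ⊢ outT I Ts ⊑ outT J Us
  sServ  : ∀ {φ} {Φ : List (Cstr φ)} {I J m K K' Ts Us} → Φ ⊨ (I =c J) →
           Pointwise (cwk m Φ ⊢_⊑_) Ts Us → Pointwise (cwk m Φ ⊢_⊑_) Us Ts →
           cwk m Φ ⊨ (K =c K') →
           Φ ⊢ serv I m K Ts ⊑ serv J m K' Us
  sServI : ∀ {φ} {Φ : List (Cstr φ)} {I m K Ts} → Φ ⊢ serv I m K Ts ⊑ iserv I m K Ts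
  sServO : ∀ {φ} {Φ : List (Cstr φ)} {I m K Ts} → Φ ⊢ serv I m K Ts ⊑ oserv I m K Ts
  sIServ : ∀ {φ} {Φ : List (Cstr φ)} {I J m K K' Ts Us} → Φ ⊨ (I =c J) →
           Pointwise (cwk m Φ ⊢_⊑_) Ts Us → cwk m Φ ⊨ (K' ≤c K) →
           Φ ⊢ iserv I m K Ts ⊑ iserv J m K' Us
  sOServ : ∀ {φ} {Φ : List (Cstr φ)} {I J m K K' Ts Us} → Φ ⊨ (I =c J) →
           Pointwise (cwk m Φ ⊢_⊑_) Us Ts → cwk m Φ ⊨ (K ≤c K') →
           Φ ⊢ oserv I m K Ts ⊑ oserv J m K' Us
  sTrans : ∀ {φ} {Φ : List (Cstr φ)} {A B C} → Φ ⊢ A ⊑ B → Φ ⊢ B ⊑ C → Φ ⊢ A ⊑ C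

-- Typing contexts: partial (a variable may be absent / deleted).
-- Ctx φ n assigns to each of the n de Bruijn variables `nothing`
-- or `just T`.

Ctx : ℕ → ℕ → Set
Ctx φ n = Vec (Maybe (Type φ)) n

data MaybeRel {A B : Set} (R : A → B → Set) : Maybe A → Maybe B → Set where
  nothing : MaybeRel R nothing nothing
  just    : ∀ {x y} → R x y → MaybeRel R (just x) (just y)

CtxSub : ∀ {φ n} → List (Cstr φ) → Ctx φ n → Ctx φ n → Set
CtxSub Φ Γ Δ = VPointwise (MaybeRel (Φ ⊢_⊑_)) Γ Δ

-- Γ₀ is a sub-context of Γ (Γ = Γ₀,Δ up to ordering)
data Part {A : Set} : Maybe A → Maybe A → Set where
  drop : ∀ {x} → Part nothing x
  keep : ∀ {T} → Part (just T) (just T)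

SubCtx : ∀ {φ n} → Ctx φ n → Ctx φ n → Set
SubCtx Γ₀ Γ = VPointwise Part Γ₀ Γ

-- advancing time  T^{-I}  (as a relation; `nothing` = undefined)
data Adv {φ} (Φ : List (Cstr φ)) (I : Idx φ) : Type φ → Maybe (Type φ) → Set where
  aBase   : ∀ {B} → Adv Φ I (base B) (just (base B))
  aCh     : ∀ {J Ts} → Φ ⊨ (I ≤c J) → Adv Φ I (ch J Ts) (just (ch (J ⊖ I) Ts))
  aCh⊥    : ∀ {J Ts} → ¬ (Φ ⊨ (I ≤c J)) → Adv Φ I (ch J Ts) nothing
  aIn     : ∀ {J Ts} → Φ ⊨ (I ≤c J) → Adv Φ I (inT J Ts) (just (inT (J ⊖ I) Ts))
  aIn⊥    : ∀ {J Ts} → ¬ (Φ ⊨ (I ≤c J)) → Adv Φ I (inT J Ts) nothing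
  aOut    : ∀ {J Ts} → Φ ⊨ (I ≤c J) → Adv Φ I (outT J Ts) (just (outT (J ⊖ I) Ts))
  aOut⊥   : ∀ {J Ts} → ¬ (Φ ⊨ (I ≤c J)) → Adv Φ I (outT J Ts) nothing
  aIServ  : ∀ {J m K Ts} → Φ ⊨ (I ≤c J) →
            Adv Φ I (iserv J m K Ts) (just (iserv (J ⊖ I) m K Ts))
  aIServ⊥ : ∀ {J m K Ts} → ¬ (Φ ⊨ (I ≤c J)) → Adv Φ I (iserv J m K Ts) nothing
  aServ   : ∀ {J m K Ts} → Φ ⊨ (I ≤c J) →
            Adv Φ I (serv J m K Ts) (just (serv (J ⊖ I) m K Ts))
  aServO  : ∀ {J m K Ts} → ¬ (Φ ⊨ (I ≤c J)) →
            Adv Φ I (serv J m K Ts) (just (oserv (J ⊖ I) m K Ts))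
  aOServ  : ∀ {J m K Ts} → Adv Φ I (oserv J m K Ts) (just (oserv (J ⊖ I) m K Ts))

data AdvM {φ} (Φ : List (Cstr φ)) (I : Idx φ) : Maybe (Type φ) → Maybe (Type φ) → Set where
  nothing : AdvM Φ I nothing nothing
  just    : ∀ {T r} → Adv Φ I T r → AdvM Φ I (just T) r

-- CtxAdv Φ I Γ Γ'  :  Γ' = Γ^{-I}  (undefined hypotheses deleted)
CtxAdv : ∀ {φ n} → List (Cstr φ) → Idx φ → Ctx φ n → Ctx φ n → Set
CtxAdv Φ I Γ Γ' = VPointwise (AdvM Φ I) Γ Γ'

data TI {φ} (Φ : List (Cstr φ)) : Maybe (Type φ) → Set where
  absent : TI Φ nothing
  tiBase : ∀ {B} → TI Φ (just (base B))
  tiOS   : ∀ {I m K Ts} → Φ ⊨ (I =c ‵ 0) → TI Φ (just (oserv I m K Ts))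

TimeInv : ∀ {φ n} → List (Cstr φ) → Ctx φ n → Set
TimeInv Φ Γ = VAll.All (TI Φ) Γ

wkCtx : ∀ {φ n} m → Ctx φ n → Ctx (m + φ) n
wkCtx m Γ = Vec.map (Data.Maybe.map (tsub (iwkσ m))) Γ
  where import Data.Maybe

binders : ∀ {φ} (Ts : List (Type φ)) → Vec (Maybe (Type φ)) (length Ts)
binders Ts = Vec.map just (Vec.fromList Ts)

-- Expressions and processes (de Bruijn, n free variables).
-- Subject positions of inputs/outputs/servers are expressions
-- (well-typed ones are necessarily variables).

infixr 5 _∷E_
data Expr (n : ℕ) : Set where
  var   : Fin n → Expr n
  zeroE : Expr n
  sucE  : Expr n → Expr n
  nilE  : Expr n
  _∷E_  : Expr n → Expr n → Expr n
  tt ff : Expr n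

infixr 4 _∥_
data Proc (n : ℕ) : Set where
  nil    : Proc n
  _∥_    : Proc n → Proc n → Proc n
  rep    : Expr n → (k : ℕ) → Proc (k + n) → Proc n
  inp    : Expr n → (k : ℕ) → Proc (k + n) → Proc n
  out    : Expr n → List (Expr n) → Proc n
  ν      : Proc (suc n) → Proc n
  matchN : Expr n → Proc n → Proc (suc n) → Proc n    -- 0 ↦ P ; s(x) ↦ Q  (x = var 0)
  matchL : Expr n → Proc n → Proc (suc (suc n)) → Proc n
           -- [] ↦ P ; x::y ↦ Q  (x = var 0, y = var 1)
  ite    : Expr n → Proc n → Proc n → Proc n
  tick   : Proc n → Proc n

esub : ∀ {m n} → (Fin m → Expr n) → Expr m → Expr n
esub σ (var x) = σ x
esub σ zeroE = zeroE
esub σ (sucE e) = sucE (esub σ e)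
esub σ nilE = nilE
esub σ (e ∷E e') = esub σ e ∷E esub σ e'
esub σ tt = tt
esub σ ff = ff

elift : ∀ {m n} k → (Fin m → Expr n) → Fin (k + m) → Expr (k + n)
elift {n = n} k σ x with splitAt k x
... | inj₁ j = var (j ↑ˡ n)
... | inj₂ i = esub (λ y → var (k ↑ʳ y)) (σ i)

psub : ∀ {m n} → (Fin m → Expr n) → Proc m → Proc n
psub σ nil = nil
psub σ (P ∥ Q) = psub σ P ∥ psub σ Q
psub σ (rep a k P) = rep (esub σ a) k (psub (elift k σ) P)
psub σ (inp a k P) = inp (esub σ a) k (psub (elift k σ) P)
psub σ (out a es) = out (esub σ a) (List.map (esub σ) es)
psub σ (ν P) = ν (psub (elift 1 σ) P)
psub σ (matchN e P Q) = matchN (esub σ e) (psub σ P) (psub (elift 1 σ) Q)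
psub σ (matchL e P Q) = matchL (esub σ e) (psub σ P) (psub (elift 2 σ) Q)
psub σ (ite e P Q) = ite (esub σ e) (psub σ P) (psub σ Q)
psub σ (tick P) = tick (psub σ P)

-- single substitution  [v := e]  for the most recently bound variable v = var zero
σ₀ : ∀ {n} → Expr n → Fin (suc n) → Expr n
σ₀ e zero = e
σ₀ e (suc x) = var x

_[_]ₑ : ∀ {n} → Expr (suc n) → Expr n → Expr n
e' [ e ]ₑ = esub (σ₀ e) e'

_[_]ₚ : ∀ {n} → Proc (suc n) → Expr n → Proc n
P [ e ]ₚ = psub (σ₀ e) P

infix 3 _⨾_⊢ₑ_∶_ _⨾_⊢_◁_

data _⨾_⊢ₑ_∶_ {φ n} (Φ : List (Cstr φ)) : Ctx φ n → Expr n → Type φ → Set where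
  tVar  : ∀ {Γ x T} → lookup Γ x ≡ just T → Φ ⨾ Γ ⊢ₑ var x ∶ T
  tZero : ∀ {Γ} → Φ ⨾ Γ ⊢ₑ zeroE ∶ base (Nat (‵ 0) (‵ 0))
  tSuc  : ∀ {Γ e I J} → Φ ⨾ Γ ⊢ₑ e ∶ base (Nat I J) →
          Φ ⨾ Γ ⊢ₑ sucE e ∶ base (Nat (I ⊕ ‵ 1) (J ⊕ ‵ 1))
  tNil  : ∀ {Γ B} → Φ ⨾ Γ ⊢ₑ nilE ∶ base (Lst (‵ 0) (‵ 0) B)
  tCons : ∀ {Γ e e' I J B} → Φ ⨾ Γ ⊢ₑ e ∶ base B → Φ ⨾ Γ ⊢ₑ e' ∶ base (Lst I J B) →
          Φ ⨾ Γ ⊢ₑ e ∷E e' ∶ base (Lst (I ⊕ ‵ 1) (J ⊕ ‵ 1) B)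
  tTT   : ∀ {Γ} → Φ ⨾ Γ ⊢ₑ tt ∶ base Bool
  tFF   : ∀ {Γ} → Φ ⨾ Γ ⊢ₑ ff ∶ base Bool
  tSubE : ∀ {Γ Δ e U T} → Φ ⨾ Δ ⊢ₑ e ∶ U → CtxSub Φ Γ Δ → Φ ⊢ U ⊑ T →
          Φ ⨾ Γ ⊢ₑ e ∶ T

data _⨾_⊢_◁_ : ∀ {φ n} → List (Cstr φ) → Ctx φ n → Proc n → Idx φ → Set where
  tNil  : ∀ {φ n} {Φ : List (Cstr φ)} {Γ : Ctx φ n} → Φ ⨾ Γ ⊢ nil ◁ ‵ 0
  tPar  : ∀ {φ n} {Φ : List (Cstr φ)} {Γ : Ctx φ n} {P Q K} →
          Φ ⨾ Γ ⊢ P ◁ K → Φ ⨾ Γ ⊢ Q ◁ K → Φ ⨾ Γ ⊢ P ∥ Q ◁ K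
  tRep  : ∀ {φ n} {Φ : List (Cstr φ)} {Γ : Ctx φ n} {a I m K Ts P}
          (Γ₀ Γ₁ Γ' : Ctx φ n) →
          Φ ⨾ Γ ⊢ₑ a ∶ iserv I m K Ts →
          SubCtx Γ₀ Γ → CtxAdv Φ I Γ₀ Γ₁ → CtxSub Φ Γ₁ Γ' → TimeInv Φ Γ' →
          cwk m Φ ⨾ (binders Ts ++ wkCtx m Γ') ⊢ P ◁ K →
          Φ ⨾ Γ ⊢ rep a (length Ts) P ◁ I
  tIn   : ∀ {φ n} {Φ : List (Cstr φ)} {Γ : Ctx φ n} {a I Ts P K} (Γ' : Ctx φ n) →
          Φ ⨾ Γ ⊢ₑ a ∶ inT I Ts → CtxAdv Φ I Γ Γ' →
          Φ ⨾ (binders Ts ++ Γ') ⊢ P ◁ K →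
          Φ ⨾ Γ ⊢ inp a (length Ts) P ◁ K ⊕ I
  tOut  : ∀ {φ n} {Φ : List (Cstr φ)} {Γ : Ctx φ n} {a I Ts es} (Γ' : Ctx φ n) →
          Φ ⨾ Γ ⊢ₑ a ∶ outT I Ts → CtxAdv Φ I Γ Γ' →
          Pointwise (λ e T → Φ ⨾ Γ' ⊢ₑ e ∶ T) es Ts →
          Φ ⨾ Γ ⊢ out a es ◁ I
  tOutS : ∀ {φ n} {Φ : List (Cstr φ)} {Γ : Ctx φ n} {a I m K Ts es} (Γ' : Ctx φ n)
          (Js : Vec (Idx φ) m) →
          Φ ⨾ Γ ⊢ₑ a ∶ oserv I m K Ts → CtxAdv Φ I Γ Γ' →
          Pointwise (λ e T → Φ ⨾ Γ' ⊢ₑ e ∶ T) es (tsub* (inst Js) Ts) →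
          Φ ⨾ Γ ⊢ out a es ◁ I ⊕ isub (inst Js) K
  tNu   : ∀ {φ n} {Φ : List (Cstr φ)} {Γ : Ctx φ n} {P K} (T : Type φ) →
          Φ ⨾ (just T ∷ Γ) ⊢ P ◁ K → Φ ⨾ Γ ⊢ ν P ◁ K
  tMatchN : ∀ {φ n} {Φ : List (Cstr φ)} {Γ : Ctx φ n} {e I J P Q K} →
          Φ ⨾ Γ ⊢ₑ e ∶ base (Nat I J) →
          ((I ≤c ‵ 0) ∷ Φ) ⨾ Γ ⊢ P ◁ K →
          ((‵ 1 ≤c J) ∷ Φ) ⨾ (just (base (Nat (I ⊖ ‵ 1) (J ⊖ ‵ 1))) ∷ Γ) ⊢ Q ◁ K →
          Φ ⨾ Γ ⊢ matchN e P Q ◁ K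
  tMatchL : ∀ {φ n} {Φ : List (Cstr φ)} {Γ : Ctx φ n} {e I J B P Q K} →
          Φ ⨾ Γ ⊢ₑ e ∶ base (Lst I J B) →
          ((I ≤c ‵ 0) ∷ Φ) ⨾ Γ ⊢ P ◁ K →
          ((‵ 1 ≤c J) ∷ Φ) ⨾ (just (base B) ∷ just (base (Lst (I ⊖ ‵ 1) (J ⊖ ‵ 1) B)) ∷ Γ)
            ⊢ Q ◁ K →
          Φ ⨾ Γ ⊢ matchL e P Q ◁ K
  tIf   : ∀ {φ n} {Φ : List (Cstr φ)} {Γ : Ctx φ n} {e P Q K} →
          Φ ⨾ Γ ⊢ₑ e ∶ base Bool → Φ ⨾ Γ ⊢ P ◁ K → Φ ⨾ Γ ⊢ Q ◁ K →
          Φ ⨾ Γ ⊢ ite e P Q ◁ K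
  tTick : ∀ {φ n} {Φ : List (Cstr φ)} {Γ : Ctx φ n} {P K} (Γ' : Ctx φ n) →
          CtxAdv Φ (‵ 1) Γ Γ' → Φ ⨾ Γ' ⊢ P ◁ K →
          Φ ⨾ Γ ⊢ tick P ◁ K ⊕ ‵ 1
  tSubP : ∀ {φ n} {Φ : List (Cstr φ)} {Γ Δ : Ctx φ n} {P K K'} →
          Φ ⨾ Δ ⊢ P ◁ K → CtxSub Φ Γ Δ → Φ ⊨ (K ≤c K') →
          Φ ⨾ Γ ⊢ P ◁ K'

module Submission where

-- The lemma is proved for every well-typed parallel substitution σ from Γ to Δ, by
-- induction on the typing derivation.  Besides typing each σ y at the type of y in Γ,
-- such a substitution has to account for every hypothesis of Δ: either its advance in
-- time is unconditional (base types and output servers), or it is the image of a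
-- hypothesis of Γ whose advance determines its own.  As entailment between constraints
-- is not decidable, this is what lets Δ follow the time shifts that the rules for
-- input, output, tick and replicated input impose on Γ.  Context subsumption and the
-- splitting of the context in the replicated-input rule are handled by weakening server
-- hypotheses of Δ to their output view wherever Γ uses them only that way.  Expression
-- typing is first put in a syntax-directed form, in which a well-typed expression is a
-- variable or has base type.

open import Defs
open import Data.Nat as ℕ using (ℕ; suc; _+_)
import Data.Nat.Properties as ℕP
open import Data.Fin as Fin using (Fin; zero; suc; _↑ˡ_; _↑ʳ_; splitAt)
import Data.Fin.Properties as FinP
open import Data.Vec as Vec using (Vec; []; _∷_; _++_; lookup)
import Data.Vec.Properties as VecP
open import Data.List as List using (List; []; _∷_)
open import Data.List.Relation.Unary.All as All using (All)
import Data.List.Relation.Unary.All.Properties as AllP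
open import Data.List.Relation.Binary.Pointwise using (Pointwise; []; _∷_)
open import Data.Vec.Relation.Binary.Pointwise.Inductive as VPW using ()
  renaming (Pointwise to VPointwise)
import Data.Vec.Relation.Unary.All.Properties as VAllP
open import Data.Maybe as Maybe using (Maybe; just; nothing)
open import Data.Maybe.Properties using (just-injective)
open import Data.Sum using (_⊎_; inj₁; inj₂)
open import Data.Product using (Σ; ∃; _,_; proj₁; proj₂; _×_)
open import Data.Empty using (⊥; ⊥-elim)
open import Data.Unit using (⊤; tt)
open import Function using (id; _∘_)
open import Relation.Binary.PropositionalEquality
open import Relation.Nullary using (¬_; Dec; yes; no)
open import Relation.Nullary.Decidable using (_×-dec_)

-- Index terms and entailment

⟦_⟧ˢ : ∀ {φ ψ} → (Fin φ → Idx ψ) → Val ψ → Val φ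
⟦ σ ⟧ˢ ρ i = ⟦ σ i ⟧ ρ

mutual
  ⟦isub⟧ : ∀ {φ ψ} (σ : Fin φ → Idx ψ) (I : Idx φ) ρ → ⟦ isub σ I ⟧ ρ ≡ ⟦ I ⟧ (⟦ σ ⟧ˢ ρ)
  ⟦isub⟧ σ (ivar i) ρ = refl
  ⟦isub⟧ σ (fn k f Is) ρ = cong f (⟦isub*⟧ σ Is ρ)

  ⟦isub*⟧ : ∀ {φ ψ k} (σ : Fin φ → Idx ψ) (Is : Vec (Idx φ) k) ρ →
            ⟦ isub* σ Is ⟧* ρ ≡ ⟦ Is ⟧* (⟦ σ ⟧ˢ ρ)
  ⟦isub*⟧ σ [] ρ = refl
  ⟦isub*⟧ σ (I ∷ Is) ρ = cong₂ _∷_ (⟦isub⟧ σ I ρ) (⟦isub*⟧ σ Is ρ)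

mutual
  ⟦⟧-cong : ∀ {φ} (I : Idx φ) {ρ ρ' : Val φ} → ρ ≗ ρ' → ⟦ I ⟧ ρ ≡ ⟦ I ⟧ ρ'
  ⟦⟧-cong (ivar i) ρ≗ρ' = ρ≗ρ' i
  ⟦⟧-cong (fn k f Is) ρ≗ρ' = cong f (⟦⟧*-cong Is ρ≗ρ')

  ⟦⟧*-cong : ∀ {φ k} (Is : Vec (Idx φ) k) {ρ ρ' : Val φ} → ρ ≗ ρ' → ⟦ Is ⟧* ρ ≡ ⟦ Is ⟧* ρ'
  ⟦⟧*-cong [] ρ≗ρ' = refl
  ⟦⟧*-cong (I ∷ Is) ρ≗ρ' = cong₂ _∷_ (⟦⟧-cong I ρ≗ρ') (⟦⟧*-cong Is ρ≗ρ')

sat-cong : ∀ {φ} (C : Cstr φ) {ρ ρ' : Val φ} → ρ ≗ ρ' → sat ρ C ≡ sat ρ' C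
sat-cong (I ≤c J) ρ≗ρ' = cong₂ ℕ._≤_ (⟦⟧-cong I ρ≗ρ') (⟦⟧-cong J ρ≗ρ')
sat-cong (I <c J) ρ≗ρ' = cong₂ ℕ._<_ (⟦⟧-cong I ρ≗ρ') (⟦⟧-cong J ρ≗ρ')
sat-cong (I =c J) ρ≗ρ' = cong₂ _≡_ (⟦⟧-cong I ρ≗ρ') (⟦⟧-cong J ρ≗ρ')
sat-cong (I ≠c J) ρ≗ρ' = cong₂ (λ a b → ¬ a ≡ b) (⟦⟧-cong I ρ≗ρ') (⟦⟧-cong J ρ≗ρ')

sat-csub : ∀ {φ ψ} (σ : Fin φ → Idx ψ) (C : Cstr φ) ρ → sat ρ (csub σ C) ≡ sat (⟦ σ ⟧ˢ ρ) C
sat-csub σ (I ≤c J) ρ = cong₂ ℕ._≤_ (⟦isub⟧ σ I ρ) (⟦isub⟧ σ J ρ)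
sat-csub σ (I <c J) ρ = cong₂ ℕ._<_ (⟦isub⟧ σ I ρ) (⟦isub⟧ σ J ρ)
sat-csub σ (I =c J) ρ = cong₂ _≡_ (⟦isub⟧ σ I ρ) (⟦isub⟧ σ J ρ)
sat-csub σ (I ≠c J) ρ = cong₂ (λ a b → ¬ a ≡ b) (⟦isub⟧ σ I ρ) (⟦isub⟧ σ J ρ)

module _ {φ ψ : ℕ} (σ : Fin φ → Idx ψ) {Φ : List (Cstr φ)} {ρ : Val ψ} where
  All-sat-csub⁺ : All (sat (⟦ σ ⟧ˢ ρ)) Φ → All (sat ρ) (List.map (csub σ) Φ)
  All-sat-csub⁺ h = AllP.map⁺ (All.map (λ {C} → subst id (sym (sat-csub σ C ρ))) h)

  All-sat-csub⁻ : All (sat ρ) (List.map (csub σ) Φ) → All (sat (⟦ σ ⟧ˢ ρ)) Φ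
  All-sat-csub⁻ h = All.map (λ {C} → subst id (sat-csub σ C ρ)) (AllP.map⁻ h)

infix 4 _⊩_ _⊨*_ _⊨⟨_⟩_

-- Φ ⊨ C unfolds to Φ ⊩ (λ ρ → sat ρ C), so the lemmas on _⊩_ apply to entailments
-- with the predicate inferred.
_⊩_ : ∀ {φ} → List (Cstr φ) → (Val φ → Set) → Set
Φ ⊩ P = ∀ ρ → All (sat ρ) Φ → P ρ

_⊨*_ : ∀ {φ} → List (Cstr φ) → List (Cstr φ) → Set
Φ' ⊨* Φ = Φ' ⊩ λ ρ → All (sat ρ) Φ

_⊨⟨_⟩_ : ∀ {φ ψ} → List (Cstr ψ) → (Fin φ → Idx ψ) → List (Cstr φ) → Set
Φ' ⊨⟨ σ ⟩ Φ = Φ' ⊩ λ ρ → All (sat (⟦ σ ⟧ˢ ρ)) Φ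

module _ {φ : ℕ} {Φ : List (Cstr φ)} where
  ⊩-pure : ∀ {P : Val φ → Set} → (∀ {ρ} → P ρ) → Φ ⊩ P
  ⊩-pure p ρ s = p

  ⊩-map : ∀ {P Q : Val φ → Set} → (∀ {ρ} → P ρ → Q ρ) → Φ ⊩ P → Φ ⊩ Q
  ⊩-map f p ρ s = f (p ρ s)

  ⊩-zipWith : ∀ {P Q R : Val φ → Set} → (∀ {ρ} → P ρ → Q ρ → R ρ) → Φ ⊩ P → Φ ⊩ Q → Φ ⊩ R
  ⊩-zipWith f p q ρ s = f (p ρ s) (q ρ s)

  ⊩-≤-respʳ : ∀ {f g h : Val φ → ℕ} →
              Φ ⊩ (λ ρ → g ρ ≡ h ρ) → Φ ⊩ (λ ρ → f ρ ℕ.≤ g ρ) → Φ ⊩ (λ ρ → f ρ ℕ.≤ h ρ)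
  ⊩-≤-respʳ = ⊩-zipWith (λ g≡h f≤g → ℕP.≤-trans f≤g (ℕP.≤-reflexive g≡h))

  ⊩-≤-respʳ⁻ : ∀ {f g h : Val φ → ℕ} →
               Φ ⊩ (λ ρ → g ρ ≡ h ρ) → Φ ⊩ (λ ρ → f ρ ℕ.≤ h ρ) → Φ ⊩ (λ ρ → f ρ ℕ.≤ g ρ)
  ⊩-≤-respʳ⁻ g≡h = ⊩-≤-respʳ (⊩-map sym g≡h)

⊩-⊨* : ∀ {φ} {Φ Φ' : List (Cstr φ)} {P} → Φ' ⊨* Φ → Φ ⊩ P → Φ' ⊩ P
⊩-⊨* Φ'⊨Φ p ρ s = p ρ (Φ'⊨Φ ρ s)

⊨-csub : ∀ {φ ψ} {σ : Fin φ → Idx ψ} {Φ Φ'} → Φ' ⊨⟨ σ ⟩ Φ → ∀ C → Φ ⊨ C → Φ' ⊨ csub σ C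
⊨-csub {σ = σ} Φ'⊨Φ C p ρ s = subst id (sym (sat-csub σ C ρ)) (p _ (Φ'⊨Φ ρ s))

∷-⊨* : ∀ {φ} (C : Cstr φ) {Φ} → (C ∷ Φ) ⊨* Φ
∷-⊨* C ρ (_ All.∷ s) = s

cwk-⊨* : ∀ {φ} m {Φ Φ' : List (Cstr φ)} → Φ' ⊨* Φ → cwk m Φ' ⊨* cwk m Φ
cwk-⊨* m Φ'⊨Φ ρ s = All-sat-csub⁺ (iwkσ m) (Φ'⊨Φ _ (All-sat-csub⁻ (iwkσ m) s))

cwk-⊨⟨iwk⟩ : ∀ {φ} m (Φ : List (Cstr φ)) → cwk m Φ ⊨⟨ iwkσ m ⟩ Φ
cwk-⊨⟨iwk⟩ m Φ ρ = All-sat-csub⁻ (iwkσ m)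

ilift-↑ʳ : ∀ {φ ψ} m (σ : Fin φ → Idx ψ) i → ilift m σ (m ↑ʳ i) ≡ isub (iwkσ m) (σ i)
ilift-↑ʳ {φ} m σ i rewrite FinP.splitAt-↑ʳ m φ i = refl

cwk-⊨⟨ilift⟩ : ∀ {φ ψ} m {σ : Fin φ → Idx ψ} {Φ' Φ} → Φ' ⊨⟨ σ ⟩ Φ →
               cwk m Φ' ⊨⟨ ilift m σ ⟩ cwk m Φ
cwk-⊨⟨ilift⟩ m {σ} Φ'⊨Φ ρ s =
  All-sat-csub⁺ (iwkσ m)
    (All.map (λ {C} → subst id (sat-cong C lifted)) (Φ'⊨Φ _ (All-sat-csub⁻ (iwkσ m) s)))
  where
  lifted : ⟦ σ ⟧ˢ (⟦ iwkσ m ⟧ˢ ρ) ≗ ⟦ iwkσ m ⟧ˢ (⟦ ilift m σ ⟧ˢ ρ)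
  lifted i = sym (trans (cong (λ X → ⟦ X ⟧ ρ) (ilift-↑ʳ m σ i)) (⟦isub⟧ (iwkσ m) (σ i) ρ))

-- Subtyping

⊑ᵇ-refl : ∀ {φ} {Φ : List (Cstr φ)} (B : BType φ) → Φ ⊢ᵇ B ⊑ B
⊑ᵇ-refl (Nat I J) = sNat (⊩-pure ℕP.≤-refl) (⊩-pure ℕP.≤-refl)
⊑ᵇ-refl (Lst I J B) = sLst (⊩-pure ℕP.≤-refl) (⊩-pure ℕP.≤-refl) (⊑ᵇ-refl B)
⊑ᵇ-refl Bool = sBool

mutual
  ⊑-refl : ∀ {φ} {Φ : List (Cstr φ)} (T : Type φ) → Φ ⊢ T ⊑ T
  ⊑-refl (base B) = sBase (⊑ᵇ-refl B)
  ⊑-refl (ch I Ts) = sCh (⊩-pure refl) (⊑*-refl Ts) (⊑*-refl Ts)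
  ⊑-refl (inT I Ts) = sIn (⊩-pure refl) (⊑*-refl Ts)
  ⊑-refl (outT I Ts) = sOut (⊩-pure refl) (⊑*-refl Ts)
  ⊑-refl (serv I m K Ts) = sServ (⊩-pure refl) (⊑*-refl Ts) (⊑*-refl Ts) (⊩-pure refl)
  ⊑-refl (iserv I m K Ts) = sIServ (⊩-pure refl) (⊑*-refl Ts) (⊩-pure ℕP.≤-refl)
  ⊑-refl (oserv I m K Ts) = sOServ (⊩-pure refl) (⊑*-refl Ts) (⊩-pure ℕP.≤-refl)

  ⊑*-refl : ∀ {φ} {Φ : List (Cstr φ)} (Ts : List (Type φ)) → Pointwise (Φ ⊢_⊑_) Ts Ts
  ⊑*-refl [] = []
  ⊑*-refl (T ∷ Ts) = ⊑-refl T ∷ ⊑*-refl Ts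

⊑ᵇ-⊨* : ∀ {φ} {Φ Φ' : List (Cstr φ)} {A B} → Φ' ⊨* Φ → Φ ⊢ᵇ A ⊑ B → Φ' ⊢ᵇ A ⊑ B
⊑ᵇ-⊨* e (sNat p q) = sNat (⊩-⊨* e p) (⊩-⊨* e q)
⊑ᵇ-⊨* e (sLst p q s) = sLst (⊩-⊨* e p) (⊩-⊨* e q) (⊑ᵇ-⊨* e s)
⊑ᵇ-⊨* e sBool = sBool
⊑ᵇ-⊨* e (sTransᵇ s t) = sTransᵇ (⊑ᵇ-⊨* e s) (⊑ᵇ-⊨* e t)

mutual
  ⊑-⊨* : ∀ {φ} {Φ Φ' : List (Cstr φ)} {A B} → Φ' ⊨* Φ → Φ ⊢ A ⊑ B → Φ' ⊢ A ⊑ B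
  ⊑-⊨* e (sBase s) = sBase (⊑ᵇ-⊨* e s)
  ⊑-⊨* e (sCh p s t) = sCh (⊩-⊨* e p) (⊑*-⊨* e s) (⊑*-⊨* e t)
  ⊑-⊨* e sChIn = sChIn
  ⊑-⊨* e sChOut = sChOut
  ⊑-⊨* e (sIn p s) = sIn (⊩-⊨* e p) (⊑*-⊨* e s)
  ⊑-⊨* e (sOut p s) = sOut (⊩-⊨* e p) (⊑*-⊨* e s)
  ⊑-⊨* e (sServ {m = m} p s t q) =
    sServ (⊩-⊨* e p) (⊑*-⊨* (cwk-⊨* m e) s) (⊑*-⊨* (cwk-⊨* m e) t) (⊩-⊨* (cwk-⊨* m e) q)
  ⊑-⊨* e sServI = sServI
  ⊑-⊨* e sServO = sServO
  ⊑-⊨* e (sIServ {m = m} p s q) = sIServ (⊩-⊨* e p) (⊑*-⊨* (cwk-⊨* m e) s) (⊩-⊨* (cwk-⊨* m e) q)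
  ⊑-⊨* e (sOServ {m = m} p s q) = sOServ (⊩-⊨* e p) (⊑*-⊨* (cwk-⊨* m e) s) (⊩-⊨* (cwk-⊨* m e) q)
  ⊑-⊨* e (sTrans s t) = sTrans (⊑-⊨* e s) (⊑-⊨* e t)

  ⊑*-⊨* : ∀ {φ} {Φ Φ' : List (Cstr φ)} {As Bs} → Φ' ⊨* Φ →
          Pointwise (Φ ⊢_⊑_) As Bs → Pointwise (Φ' ⊢_⊑_) As Bs
  ⊑*-⊨* e [] = []
  ⊑*-⊨* e (s ∷ ss) = ⊑-⊨* e s ∷ ⊑*-⊨* e ss

⊑ᵇ-bsub : ∀ {φ ψ} (σ : Fin φ → Idx ψ) {Φ Φ'} {A B} → Φ' ⊨⟨ σ ⟩ Φ → Φ ⊢ᵇ A ⊑ B →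
          Φ' ⊢ᵇ bsub σ A ⊑ bsub σ B
⊑ᵇ-bsub σ e (sNat {I} {J} {I'} {J'} p q) = sNat (⊨-csub e (I' ≤c I) p) (⊨-csub e (J ≤c J') q)
⊑ᵇ-bsub σ e (sLst {I} {J} {I'} {J'} p q s) =
  sLst (⊨-csub e (I' ≤c I) p) (⊨-csub e (J ≤c J') q) (⊑ᵇ-bsub σ e s)
⊑ᵇ-bsub σ e sBool = sBool
⊑ᵇ-bsub σ e (sTransᵇ s t) = sTransᵇ (⊑ᵇ-bsub σ e s) (⊑ᵇ-bsub σ e t)

mutual
  ⊑-tsub : ∀ {φ ψ} (σ : Fin φ → Idx ψ) {Φ Φ'} {A B} → Φ' ⊨⟨ σ ⟩ Φ → Φ ⊢ A ⊑ B →
           Φ' ⊢ tsub σ A ⊑ tsub σ B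
  ⊑-tsub σ e (sBase s) = sBase (⊑ᵇ-bsub σ e s)
  ⊑-tsub σ e (sCh {I = I} {J} p s t) = sCh (⊨-csub e (I =c J) p) (⊑*-tsub σ e s) (⊑*-tsub σ e t)
  ⊑-tsub σ e sChIn = sChIn
  ⊑-tsub σ e sChOut = sChOut
  ⊑-tsub σ e (sIn {I = I} {J} p s) = sIn (⊨-csub e (I =c J) p) (⊑*-tsub σ e s)
  ⊑-tsub σ e (sOut {I = I} {J} p s) = sOut (⊨-csub e (I =c J) p) (⊑*-tsub σ e s)
  ⊑-tsub σ e (sServ {I = I} {J} {m} {K} {K'} p s t q) =
    sServ (⊨-csub e (I =c J) p) (⊑*-tsub (ilift m σ) e↑ s) (⊑*-tsub (ilift m σ) e↑ t)
          (⊨-csub e↑ (K =c K') q)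
    where e↑ = cwk-⊨⟨ilift⟩ m e
  ⊑-tsub σ e sServI = sServI
  ⊑-tsub σ e sServO = sServO
  ⊑-tsub σ e (sIServ {I = I} {J} {m} {K} {K'} p s q) =
    sIServ (⊨-csub e (I =c J) p) (⊑*-tsub (ilift m σ) e↑ s) (⊨-csub e↑ (K' ≤c K) q)
    where e↑ = cwk-⊨⟨ilift⟩ m e
  ⊑-tsub σ e (sOServ {I = I} {J} {m} {K} {K'} p s q) =
    sOServ (⊨-csub e (I =c J) p) (⊑*-tsub (ilift m σ) e↑ s) (⊨-csub e↑ (K ≤c K') q)
    where e↑ = cwk-⊨⟨ilift⟩ m e
  ⊑-tsub σ e (sTrans s t) = sTrans (⊑-tsub σ e s) (⊑-tsub σ e t)

  ⊑*-tsub : ∀ {φ ψ} (σ : Fin φ → Idx ψ) {Φ Φ'} {As Bs} → Φ' ⊨⟨ σ ⟩ Φ →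
            Pointwise (Φ ⊢_⊑_) As Bs → Pointwise (Φ' ⊢_⊑_) (tsub* σ As) (tsub* σ Bs)
  ⊑*-tsub σ e [] = []
  ⊑*-tsub σ e (s ∷ ss) = ⊑-tsub σ e s ∷ ⊑*-tsub σ e ss

-- What a derivation of A ⊑ B keeps through transitivity: compatible head constructors
-- and entailed equality of the time indices.
data Head {φ} (Φ : List (Cstr φ)) : Type φ → Type φ → Set where
  base-base   : ∀ {B B'} → Head Φ (base B) (base B')
  ch-ch       : ∀ {I J Ts Us} → Φ ⊨ (I =c J) → Head Φ (ch I Ts) (ch J Us)
  ch-in       : ∀ {I J Ts Us} → Φ ⊨ (I =c J) → Head Φ (ch I Ts) (inT J Us)
  ch-out      : ∀ {I J Ts Us} → Φ ⊨ (I =c J) → Head Φ (ch I Ts) (outT J Us)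
  in-in       : ∀ {I J Ts Us} → Φ ⊨ (I =c J) → Head Φ (inT I Ts) (inT J Us)
  out-out     : ∀ {I J Ts Us} → Φ ⊨ (I =c J) → Head Φ (outT I Ts) (outT J Us)
  serv-serv   : ∀ {I J m m' K K' Ts Us} → Φ ⊨ (I =c J) → Head Φ (serv I m K Ts) (serv J m' K' Us)
  serv-iserv  : ∀ {I J m m' K K' Ts Us} → Φ ⊨ (I =c J) → Head Φ (serv I m K Ts) (iserv J m' K' Us)
  serv-oserv  : ∀ {I J m m' K K' Ts Us} → Φ ⊨ (I =c J) → Head Φ (serv I m K Ts) (oserv J m' K' Us)
  iserv-iserv : ∀ {I J m m' K K' Ts Us} → Φ ⊨ (I =c J) → Head Φ (iserv I m K Ts) (iserv J m' K' Us)
  oserv-oserv : ∀ {I J m m' K K' Ts Us} → Φ ⊨ (I =c J) → Head Φ (oserv I m K Ts) (oserv J m' K' Us)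

module _ {φ : ℕ} {Φ : List (Cstr φ)} where
  Head-trans : ∀ {A B C} → Head Φ A B → Head Φ B C → Head Φ A C
  Head-trans base-base base-base = base-base
  Head-trans (ch-ch p) (ch-ch q) = ch-ch (⊩-zipWith trans p q)
  Head-trans (ch-ch p) (ch-in q) = ch-in (⊩-zipWith trans p q)
  Head-trans (ch-ch p) (ch-out q) = ch-out (⊩-zipWith trans p q)
  Head-trans (ch-in p) (in-in q) = ch-in (⊩-zipWith trans p q)
  Head-trans (ch-out p) (out-out q) = ch-out (⊩-zipWith trans p q)
  Head-trans (in-in p) (in-in q) = in-in (⊩-zipWith trans p q)
  Head-trans (out-out p) (out-out q) = out-out (⊩-zipWith trans p q)
  Head-trans (serv-serv p) (serv-serv q) = serv-serv (⊩-zipWith trans p q)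
  Head-trans (serv-serv p) (serv-iserv q) = serv-iserv (⊩-zipWith trans p q)
  Head-trans (serv-serv p) (serv-oserv q) = serv-oserv (⊩-zipWith trans p q)
  Head-trans (serv-iserv p) (iserv-iserv q) = serv-iserv (⊩-zipWith trans p q)
  Head-trans (serv-oserv p) (oserv-oserv q) = serv-oserv (⊩-zipWith trans p q)
  Head-trans (iserv-iserv p) (iserv-iserv q) = iserv-iserv (⊩-zipWith trans p q)
  Head-trans (oserv-oserv p) (oserv-oserv q) = oserv-oserv (⊩-zipWith trans p q)

  ⊑⇒Head : ∀ {A B} → Φ ⊢ A ⊑ B → Head Φ A B
  ⊑⇒Head (sBase _) = base-base
  ⊑⇒Head (sCh p _ _) = ch-ch p
  ⊑⇒Head sChIn = ch-in (⊩-pure refl)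
  ⊑⇒Head sChOut = ch-out (⊩-pure refl)
  ⊑⇒Head (sIn p _) = in-in p
  ⊑⇒Head (sOut p _) = out-out p
  ⊑⇒Head (sServ p _ _ _) = serv-serv p
  ⊑⇒Head sServI = serv-iserv (⊩-pure refl)
  ⊑⇒Head sServO = serv-oserv (⊩-pure refl)
  ⊑⇒Head (sIServ p _ _) = iserv-iserv p
  ⊑⇒Head (sOServ p _ _) = oserv-oserv p
  ⊑⇒Head (sTrans s t) = Head-trans (⊑⇒Head s) (⊑⇒Head t)

  ⊑-baseʳ : ∀ {A B} → Φ ⊢ A ⊑ base B → ∃ λ B' → A ≡ base B'
  ⊑-baseʳ s with ⊑⇒Head s
  ... | base-base = _ , refl

  ⊑-baseˡ : ∀ {A B} → Φ ⊢ base B ⊑ A → ∃ λ B' → A ≡ base B'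
  ⊑-baseˡ s with ⊑⇒Head s
  ... | base-base = _ , refl

data OServable {φ} : Type φ → Set where
  isServ  : ∀ {I m K Ts} → OServable (serv I m K Ts)
  isOServ : ∀ {I m K Ts} → OServable (oserv I m K Ts)

Head-OServable⁻ : ∀ {φ} {Φ : List (Cstr φ)} {A B} → Head Φ A B → OServable B → OServable A
Head-OServable⁻ (serv-serv _) isServ = isServ
Head-OServable⁻ (serv-oserv _) isOServ = isServ
Head-OServable⁻ (oserv-oserv _) isOServ = isOServ

retime : ∀ {φ} → Idx φ → Type φ → Type φ
retime K (base B) = base B
retime K (ch J Ts) = ch (J ⊖ K) Ts
retime K (inT J Ts) = inT (J ⊖ K) Ts
retime K (outT J Ts) = outT (J ⊖ K) Ts
retime K (serv J m L Ts) = serv (J ⊖ K) m L Ts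
retime K (iserv J m L Ts) = iserv (J ⊖ K) m L Ts
retime K (oserv J m L Ts) = oserv (J ⊖ K) m L Ts

⊑-retime : ∀ {φ} {Φ : List (Cstr φ)} K {A B} → Φ ⊢ A ⊑ B → Φ ⊢ retime K A ⊑ retime K B
⊑-retime K (sBase s) = sBase s
⊑-retime K (sCh p s t) = sCh (⊩-map (λ {ρ} → cong (ℕ._∸ ⟦ K ⟧ ρ)) p) s t
⊑-retime K sChIn = sChIn
⊑-retime K sChOut = sChOut
⊑-retime K (sIn p s) = sIn (⊩-map (λ {ρ} → cong (ℕ._∸ ⟦ K ⟧ ρ)) p) s
⊑-retime K (sOut p s) = sOut (⊩-map (λ {ρ} → cong (ℕ._∸ ⟦ K ⟧ ρ)) p) s
⊑-retime K (sServ p s t q) = sServ (⊩-map (λ {ρ} → cong (ℕ._∸ ⟦ K ⟧ ρ)) p) s t q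
⊑-retime K sServI = sServI
⊑-retime K sServO = sServO
⊑-retime K (sIServ p s q) = sIServ (⊩-map (λ {ρ} → cong (ℕ._∸ ⟦ K ⟧ ρ)) p) s q
⊑-retime K (sOServ p s q) = sOServ (⊩-map (λ {ρ} → cong (ℕ._∸ ⟦ K ⟧ ρ)) p) s q
⊑-retime K (sTrans s t) = sTrans (⊑-retime K s) (⊑-retime K t)

OServable-retime : ∀ {φ} (K : Idx φ) {A} → OServable A → OServable (retime K A)
OServable-retime K isServ = isServ
OServable-retime K isOServ = isOServ

oview : ∀ {φ} → Type φ → Type φ
oview (serv I m K Ts) = oserv I m K Ts
oview T = T

⊑oview : ∀ {φ} {Φ : List (Cstr φ)} {A} → OServable A → Φ ⊢ A ⊑ oview A
⊑oview isServ = sServO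
⊑oview {A = oserv I m K Ts} isOServ = ⊑-refl (oserv I m K Ts)

⊑-oview : ∀ {φ} {Φ : List (Cstr φ)} {A B} → Φ ⊢ A ⊑ B → OServable B → Φ ⊢ oview A ⊑ oview B
⊑-oview (sServ p s t q) isServ = sOServ p t (⊩-map (λ e → ℕP.≤-reflexive e) q)
⊑-oview (sServO {I = I} {m} {K} {Ts}) isOServ = ⊑-refl (oserv I m K Ts)
⊑-oview (sOServ p s q) isOServ = sOServ p s q
⊑-oview (sTrans s t) B↑ = sTrans (⊑-oview s (Head-OServable⁻ (⊑⇒Head t) B↑)) (⊑-oview t B↑)

-- Advancing time

data Kind : Set where
  baseᴷ chᴷ inᴷ outᴷ servᴷ iservᴷ oservᴷ : Kind

kind : ∀ {φ} → Type φ → Kind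
kind (base _) = baseᴷ
kind (ch _ _) = chᴷ
kind (inT _ _) = inᴷ
kind (outT _ _) = outᴷ
kind (serv _ _ _ _) = servᴷ
kind (iserv _ _ _ _) = iservᴷ
kind (oserv _ _ _ _) = oservᴷ

kind-tsub : ∀ {φ ψ} (σ : Fin φ → Idx ψ) A → kind (tsub σ A) ≡ kind A
kind-tsub σ (base _) = refl
kind-tsub σ (ch _ _) = refl
kind-tsub σ (inT _ _) = refl
kind-tsub σ (outT _ _) = refl
kind-tsub σ (serv _ _ _ _) = refl
kind-tsub σ (iserv _ _ _ _) = refl
kind-tsub σ (oserv _ _ _ _) = refl

-- Types whose advance in time is defined without deciding an entailment.
StableKind : Kind → Set
StableKind baseᴷ = ⊤
StableKind oservᴷ = ⊤
StableKind _ = ⊥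

Stable : ∀ {φ} → Type φ → Set
Stable A = StableKind (kind A)

Stable-tsub : ∀ {φ ψ} (σ : Fin φ → Idx ψ) D → Stable D → Stable (tsub σ D)
Stable-tsub σ D rewrite kind-tsub σ D = id

-- A hypothesis of type D standing for a hypothesis of type A can be advanced whenever
-- the latter can, except when A is only the output view of the server D.
Tracks : ∀ {φ} → Type φ → Type φ → Set
Tracks D A = kind D ≡ servᴷ → kind A ≢ oservᴷ

Tracks-refl : ∀ {φ} (D : Type φ) → Tracks D D
Tracks-refl D D-serv D-oserv with trans (sym D-serv) D-oserv
... | ()

Tracks-tsub : ∀ {φ ψ} (σ : Fin φ → Idx ψ) D A → Tracks D A → Tracks (tsub σ D) (tsub σ A)
Tracks-tsub σ D A rewrite kind-tsub σ D | kind-tsub σ A = id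

module _ {φ : ℕ} {Φ : List (Cstr φ)} {K : Idx φ} where

  Adv-⊑ : ∀ {D A A₁ d} → Φ ⊢ D ⊑ A → Adv Φ K A (just A₁) → Adv Φ K D d →
          ∃ λ D₁ → d ≡ just D₁ × Φ ⊢ D₁ ⊑ A₁
  Adv-⊑ s A→ D→ with ⊑⇒Head s
  Adv-⊑ s aBase aBase | base-base = _ , refl , s
  Adv-⊑ s (aCh _) (aCh _) | ch-ch _ = _ , refl , ⊑-retime K s
  Adv-⊑ s (aIn _) (aCh _) | ch-in _ = _ , refl , ⊑-retime K s
  Adv-⊑ s (aOut _) (aCh _) | ch-out _ = _ , refl , ⊑-retime K s
  Adv-⊑ s (aIn _) (aIn _) | in-in _ = _ , refl , ⊑-retime K s
  Adv-⊑ s (aOut _) (aOut _) | out-out _ = _ , refl , ⊑-retime K s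
  Adv-⊑ s (aServ _) (aServ _) | serv-serv _ = _ , refl , ⊑-retime K s
  Adv-⊑ s (aServO _) (aServO _) | serv-serv _ = _ , refl , ⊑-oview (⊑-retime K s) isServ
  Adv-⊑ s (aIServ _) (aServ _) | serv-iserv _ = _ , refl , ⊑-retime K s
  Adv-⊑ s aOServ (aServ _) | serv-oserv _ = _ , refl , ⊑-retime K s
  Adv-⊑ s aOServ (aServO _) | serv-oserv _ = _ , refl , ⊑-oview (⊑-retime K s) isOServ
  Adv-⊑ s (aIServ _) (aIServ _) | iserv-iserv _ = _ , refl , ⊑-retime K s
  Adv-⊑ s aOServ aOServ | oserv-oserv _ = _ , refl , ⊑-retime K s
  Adv-⊑ s (aCh K≤J) (aCh⊥ K≰I) | ch-ch I=J = ⊥-elim (K≰I (⊩-≤-respʳ⁻ I=J K≤J))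
  Adv-⊑ s (aIn K≤J) (aCh⊥ K≰I) | ch-in I=J = ⊥-elim (K≰I (⊩-≤-respʳ⁻ I=J K≤J))
  Adv-⊑ s (aOut K≤J) (aCh⊥ K≰I) | ch-out I=J = ⊥-elim (K≰I (⊩-≤-respʳ⁻ I=J K≤J))
  Adv-⊑ s (aIn K≤J) (aIn⊥ K≰I) | in-in I=J = ⊥-elim (K≰I (⊩-≤-respʳ⁻ I=J K≤J))
  Adv-⊑ s (aOut K≤J) (aOut⊥ K≰I) | out-out I=J = ⊥-elim (K≰I (⊩-≤-respʳ⁻ I=J K≤J))
  Adv-⊑ s (aServ K≤J) (aServO K≰I) | serv-serv I=J = ⊥-elim (K≰I (⊩-≤-respʳ⁻ I=J K≤J))
  Adv-⊑ s (aServO K≰J) (aServ K≤I) | serv-serv I=J = ⊥-elim (K≰J (⊩-≤-respʳ I=J K≤I))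
  Adv-⊑ s (aIServ K≤J) (aServO K≰I) | serv-iserv I=J = ⊥-elim (K≰I (⊩-≤-respʳ⁻ I=J K≤J))
  Adv-⊑ s (aIServ K≤J) (aIServ⊥ K≰I) | iserv-iserv I=J = ⊥-elim (K≰I (⊩-≤-respʳ⁻ I=J K≤J))

  Adv-along-Head : ∀ {D A a} → Tracks D A → Head Φ D A → Adv Φ K A a → ∃ (Adv Φ K D)
  Adv-along-Head t base-base aBase = _ , aBase
  Adv-along-Head t (ch-ch I=J) (aCh K≤J) = _ , aCh (⊩-≤-respʳ⁻ I=J K≤J)
  Adv-along-Head t (ch-ch I=J) (aCh⊥ K≰J) = _ , aCh⊥ (K≰J ∘ ⊩-≤-respʳ I=J)
  Adv-along-Head t (ch-in I=J) (aIn K≤J) = _ , aCh (⊩-≤-respʳ⁻ I=J K≤J)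
  Adv-along-Head t (ch-in I=J) (aIn⊥ K≰J) = _ , aCh⊥ (K≰J ∘ ⊩-≤-respʳ I=J)
  Adv-along-Head t (ch-out I=J) (aOut K≤J) = _ , aCh (⊩-≤-respʳ⁻ I=J K≤J)
  Adv-along-Head t (ch-out I=J) (aOut⊥ K≰J) = _ , aCh⊥ (K≰J ∘ ⊩-≤-respʳ I=J)
  Adv-along-Head t (in-in I=J) (aIn K≤J) = _ , aIn (⊩-≤-respʳ⁻ I=J K≤J)
  Adv-along-Head t (in-in I=J) (aIn⊥ K≰J) = _ , aIn⊥ (K≰J ∘ ⊩-≤-respʳ I=J)
  Adv-along-Head t (out-out I=J) (aOut K≤J) = _ , aOut (⊩-≤-respʳ⁻ I=J K≤J)
  Adv-along-Head t (out-out I=J) (aOut⊥ K≰J) = _ , aOut⊥ (K≰J ∘ ⊩-≤-respʳ I=J)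
  Adv-along-Head t (serv-serv I=J) (aServ K≤J) = _ , aServ (⊩-≤-respʳ⁻ I=J K≤J)
  Adv-along-Head t (serv-serv I=J) (aServO K≰J) = _ , aServO (K≰J ∘ ⊩-≤-respʳ I=J)
  Adv-along-Head t (serv-iserv I=J) (aIServ K≤J) = _ , aServ (⊩-≤-respʳ⁻ I=J K≤J)
  Adv-along-Head t (serv-iserv I=J) (aIServ⊥ K≰J) = _ , aServO (K≰J ∘ ⊩-≤-respʳ I=J)
  Adv-along-Head t (serv-oserv _) aOServ = ⊥-elim (t refl refl)
  Adv-along-Head t (iserv-iserv I=J) (aIServ K≤J) = _ , aIServ (⊩-≤-respʳ⁻ I=J K≤J)
  Adv-along-Head t (iserv-iserv I=J) (aIServ⊥ K≰J) = _ , aIServ⊥ (K≰J ∘ ⊩-≤-respʳ I=J)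
  Adv-along-Head t (oserv-oserv _) aOServ = _ , aOServ

  Adv-Tracks : ∀ {D A a D₁} → Tracks D A → Head Φ D A → Adv Φ K A a → Adv Φ K D (just D₁) →
               (∃ λ A₁ → a ≡ just A₁ × Tracks D₁ A₁) ⊎ Stable D₁
  Adv-Tracks t base-base aBase aBase = inj₂ tt
  Adv-Tracks t (ch-ch _) (aCh _) (aCh _) = inj₁ (_ , refl , λ ())
  Adv-Tracks t (ch-in _) (aIn _) (aCh _) = inj₁ (_ , refl , λ ())
  Adv-Tracks t (ch-out _) (aOut _) (aCh _) = inj₁ (_ , refl , λ ())
  Adv-Tracks t (in-in _) (aIn _) (aIn _) = inj₁ (_ , refl , λ ())
  Adv-Tracks t (out-out _) (aOut _) (aOut _) = inj₁ (_ , refl , λ ())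
  Adv-Tracks t (serv-serv _) (aServ _) (aServ _) = inj₁ (_ , refl , λ _ ())
  Adv-Tracks t (serv-serv _) _ (aServO _) = inj₂ tt
  Adv-Tracks t (serv-iserv _) (aIServ _) (aServ _) = inj₁ (_ , refl , λ _ ())
  Adv-Tracks t (serv-iserv _) _ (aServO _) = inj₂ tt
  Adv-Tracks t (serv-oserv _) _ _ = ⊥-elim (t refl refl)
  Adv-Tracks t (iserv-iserv _) (aIServ _) (aIServ _) = inj₁ (_ , refl , λ ())
  Adv-Tracks t (oserv-oserv _) _ aOServ = inj₂ tt
  Adv-Tracks t (ch-ch I=J) (aCh⊥ K≰J) (aCh K≤I) = ⊥-elim (K≰J (⊩-≤-respʳ I=J K≤I))
  Adv-Tracks t (ch-in I=J) (aIn⊥ K≰J) (aCh K≤I) = ⊥-elim (K≰J (⊩-≤-respʳ I=J K≤I))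
  Adv-Tracks t (ch-out I=J) (aOut⊥ K≰J) (aCh K≤I) = ⊥-elim (K≰J (⊩-≤-respʳ I=J K≤I))
  Adv-Tracks t (in-in I=J) (aIn⊥ K≰J) (aIn K≤I) = ⊥-elim (K≰J (⊩-≤-respʳ I=J K≤I))
  Adv-Tracks t (out-out I=J) (aOut⊥ K≰J) (aOut K≤I) = ⊥-elim (K≰J (⊩-≤-respʳ I=J K≤I))
  Adv-Tracks t (serv-serv I=J) (aServO K≰J) (aServ K≤I) = ⊥-elim (K≰J (⊩-≤-respʳ I=J K≤I))
  Adv-Tracks t (serv-iserv I=J) (aIServ⊥ K≰J) (aServ K≤I) = ⊥-elim (K≰J (⊩-≤-respʳ I=J K≤I))
  Adv-Tracks t (iserv-iserv I=J) (aIServ⊥ K≰J) (aIServ K≤I) = ⊥-elim (K≰J (⊩-≤-respʳ I=J K≤I))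

  Stable-Adv : ∀ {D} → Stable D → ∃ (Adv Φ K D)
  Stable-Adv {base _} _ = _ , aBase
  Stable-Adv {oserv _ _ _ _} _ = _ , aOServ

  Adv-Stable : ∀ {D D₁} → Stable D → Adv Φ K D (just D₁) → Stable D₁
  Adv-Stable _ aBase = tt
  Adv-Stable _ aOServ = tt

  Adv-OServable⁻ : ∀ {A A₁} → Adv Φ K A (just A₁) → OServable A₁ →
                   OServable A × oview A₁ ≡ oview (retime K A)
  Adv-OServable⁻ (aServ _) isServ = isServ , refl
  Adv-OServable⁻ (aServO _) isOServ = isServ , refl
  Adv-OServable⁻ aOServ isOServ = isOServ , refl

  Adv-base : ∀ {B A₁} → Adv Φ K (base B) (just A₁) → A₁ ≡ base B
  Adv-base aBase = refl

  Adv-base⁻ : ∀ {A B} → Adv Φ K A (just (base B)) → A ≡ base B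
  Adv-base⁻ aBase = refl

  base⊑-Adv : ∀ {X A A₁} → Φ ⊢ base X ⊑ A → Adv Φ K A (just A₁) → Φ ⊢ base X ⊑ A₁
  base⊑-Adv s A→ with ⊑-baseˡ s
  base⊑-Adv s aBase | _ , refl = s

-- Contexts

VPointwise-tabulateʳ : ∀ {A B : Set} {R : A → B → Set} {n} (xs : Vec A n) {g : Fin n → B} →
                       (∀ i → R (lookup xs i) (g i)) → VPointwise R xs (Vec.tabulate g)
VPointwise-tabulateʳ {R = R} xs {g} h =
  subst (λ v → VPointwise R v (Vec.tabulate g)) (VecP.tabulate∘lookup xs) (VPW.tabulate⁺ h)

data Split++ (k m : ℕ) : Fin (k + m) → Set where
  inˡ : ∀ j → Split++ k m (j ↑ˡ m)
  inʳ : ∀ i → Split++ k m (k ↑ʳ i)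

split++ : ∀ k m y → Split++ k m y
split++ k m y with splitAt k y | FinP.join-splitAt k m y
... | inj₁ j | eq = subst (Split++ k m) eq (inˡ j)
... | inj₂ i | eq = subst (Split++ k m) eq (inʳ i)

elift-↑ˡ : ∀ {m n} k (σ : Fin m → Expr n) j → elift k σ (j ↑ˡ m) ≡ var (j ↑ˡ n)
elift-↑ˡ {m} k σ j rewrite FinP.splitAt-↑ˡ k j m = refl

elift-↑ʳ : ∀ {m n} k (σ : Fin m → Expr n) i →
           elift k σ (k ↑ʳ i) ≡ esub (var ∘ (k ↑ʳ_)) (σ i)
elift-↑ʳ {m} k σ i rewrite FinP.splitAt-↑ʳ k m i = refl

_≟var_ : ∀ {n} (e : Expr n) (x : Fin n) → Dec (e ≡ var x)
var y ≟var x with y Fin.≟ x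
... | yes refl = yes refl
... | no y≢x = no λ { refl → y≢x refl }
zeroE ≟var x = no λ ()
sucE e ≟var x = no λ ()
nilE ≟var x = no λ ()
(e ∷E e') ≟var x = no λ ()
tt ≟var x = no λ ()
ff ≟var x = no λ ()

CtxSub-refl : ∀ {φ n} {Φ : List (Cstr φ)} (Δ : Ctx φ n) → CtxSub Φ Δ Δ
CtxSub-refl Δ = VPW.refl (λ { {nothing} → nothing ; {just T} → just (⊑-refl T) })

module _ {φ n : ℕ} {Φ : List (Cstr φ)} {Γ Γ' : Ctx φ n} where
  CtxSub-lookup : CtxSub Φ Γ Γ' → ∀ y {A} → lookup Γ y ≡ just A →
                  ∃ λ A' → lookup Γ' y ≡ just A' × Φ ⊢ A ⊑ A'
  CtxSub-lookup Γ⊑Γ' y eq with lookup Γ y | lookup Γ' y | VPW.lookup Γ⊑Γ' y | eq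
  ... | _ | just A' | just s | refl = A' , refl , s

  CtxSub-lookup⁻ : CtxSub Φ Γ Γ' → ∀ y {A'} → lookup Γ' y ≡ just A' →
                   ∃ λ A → lookup Γ y ≡ just A × Φ ⊢ A ⊑ A'
  CtxSub-lookup⁻ Γ⊑Γ' y eq with lookup Γ y | lookup Γ' y | VPW.lookup Γ⊑Γ' y | eq
  ... | just A | _ | just s | refl = A , refl , s

module _ {φ n : ℕ} {Φ : List (Cstr φ)} {K : Idx φ} {Γ Γ' : Ctx φ n} where
  CtxAdv-lookup : CtxAdv Φ K Γ Γ' → ∀ y {A} → lookup Γ y ≡ just A → Adv Φ K A (lookup Γ' y)
  CtxAdv-lookup Γ→Γ' y eq with lookup Γ y | VPW.lookup Γ→Γ' y | eq
  ... | _ | just a | refl = a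

  CtxAdv-lookup⁻ : CtxAdv Φ K Γ Γ' → ∀ y {A₁} → lookup Γ' y ≡ just A₁ →
                   ∃ λ A → lookup Γ y ≡ just A × Adv Φ K A (just A₁)
  CtxAdv-lookup⁻ Γ→Γ' y eq with lookup Γ y | lookup Γ' y | VPW.lookup Γ→Γ' y | eq
  ... | just A | _ | just a | refl = A , refl , a

SubCtx-lookup : ∀ {φ n} {Γ₀ Γ : Ctx φ n} → SubCtx Γ₀ Γ → ∀ y {A} →
                lookup Γ₀ y ≡ just A → lookup Γ y ≡ just A
SubCtx-lookup {Γ₀ = Γ₀} {Γ} Γ₀⊆Γ y eq with lookup Γ₀ y | lookup Γ y | VPW.lookup Γ₀⊆Γ y | eq
... | _ | _ | keep | refl = refl

KeepsBase : ∀ {φ n} → Ctx φ n → Ctx φ n → Set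
KeepsBase Δ Δ' = ∀ y {B} → lookup Δ y ≡ just (base B) → lookup Δ' y ≡ just (base B)

-- Syntax-directed expression typing

infix 3 _⨾_⊢ᶜ_∶_
_⨾_⊢ᶜ_∶_ : ∀ {φ n} → List (Cstr φ) → Ctx φ n → Expr n → Type φ → Set
_⨾_⊢ᶜ_∶_ {φ} Φ Δ (var x) T = ∃ λ D → lookup Δ x ≡ just D × Φ ⊢ D ⊑ T
Φ ⨾ Δ ⊢ᶜ zeroE ∶ T = Φ ⊢ base (Nat (‵ 0) (‵ 0)) ⊑ T
_⨾_⊢ᶜ_∶_ {φ} Φ Δ (sucE e) T = Σ (Idx φ) λ I → Σ (Idx φ) λ J →
  Φ ⨾ Δ ⊢ᶜ e ∶ base (Nat I J) × Φ ⊢ base (Nat (I ⊕ ‵ 1) (J ⊕ ‵ 1)) ⊑ T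
_⨾_⊢ᶜ_∶_ {φ} Φ Δ nilE T = Σ (BType φ) λ B → Φ ⊢ base (Lst (‵ 0) (‵ 0) B) ⊑ T
_⨾_⊢ᶜ_∶_ {φ} Φ Δ (e ∷E e') T = Σ (Idx φ) λ I → Σ (Idx φ) λ J → Σ (BType φ) λ B →
  Φ ⨾ Δ ⊢ᶜ e ∶ base B × Φ ⨾ Δ ⊢ᶜ e' ∶ base (Lst I J B) × Φ ⊢ base (Lst (I ⊕ ‵ 1) (J ⊕ ‵ 1) B) ⊑ T
Φ ⨾ Δ ⊢ᶜ tt ∶ T = Φ ⊢ base Bool ⊑ T
Φ ⨾ Δ ⊢ᶜ ff ∶ T = Φ ⊢ base Bool ⊑ T

module _ {φ n : ℕ} {Φ : List (Cstr φ)} where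

  ⊢ᶜ-⊑ : ∀ {Δ : Ctx φ n} e {T U} → Φ ⨾ Δ ⊢ᶜ e ∶ T → Φ ⊢ T ⊑ U → Φ ⨾ Δ ⊢ᶜ e ∶ U
  ⊢ᶜ-⊑ (var x) (D , eq , s) t = D , eq , sTrans s t
  ⊢ᶜ-⊑ zeroE s t = sTrans s t
  ⊢ᶜ-⊑ (sucE e) (I , J , d , s) t = I , J , d , sTrans s t
  ⊢ᶜ-⊑ nilE (B , s) t = B , sTrans s t
  ⊢ᶜ-⊑ (e ∷E e') (I , J , B , d , d' , s) t = I , J , B , d , d' , sTrans s t
  ⊢ᶜ-⊑ tt s t = sTrans s t
  ⊢ᶜ-⊑ ff s t = sTrans s t

  ⊢ᶜ-ctx : ∀ {Δ Δ' : Ctx φ n} e {T} → CtxSub Φ Δ Δ' → Φ ⨾ Δ' ⊢ᶜ e ∶ T → Φ ⨾ Δ ⊢ᶜ e ∶ T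
  ⊢ᶜ-ctx (var x) Δ⊑Δ' (D , eq , s) with CtxSub-lookup⁻ Δ⊑Δ' x eq
  ... | D₀ , eq₀ , s₀ = D₀ , eq₀ , sTrans s₀ s
  ⊢ᶜ-ctx zeroE Δ⊑Δ' s = s
  ⊢ᶜ-ctx (sucE e) Δ⊑Δ' (I , J , d , s) = I , J , ⊢ᶜ-ctx e Δ⊑Δ' d , s
  ⊢ᶜ-ctx nilE Δ⊑Δ' s = s
  ⊢ᶜ-ctx (e ∷E e') Δ⊑Δ' (I , J , B , d , d' , s) =
    I , J , B , ⊢ᶜ-ctx e Δ⊑Δ' d , ⊢ᶜ-ctx e' Δ⊑Δ' d' , s
  ⊢ᶜ-ctx tt Δ⊑Δ' s = s
  ⊢ᶜ-ctx ff Δ⊑Δ' s = s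

  ⊢ₑ⇒⊢ᶜ : ∀ {Δ : Ctx φ n} {e T} → Φ ⨾ Δ ⊢ₑ e ∶ T → Φ ⨾ Δ ⊢ᶜ e ∶ T
  ⊢ₑ⇒⊢ᶜ (tVar {T = T} eq) = T , eq , ⊑-refl T
  ⊢ₑ⇒⊢ᶜ tZero = ⊑-refl _
  ⊢ₑ⇒⊢ᶜ (tSuc {I = I} {J} d) = I , J , ⊢ₑ⇒⊢ᶜ d , ⊑-refl _
  ⊢ₑ⇒⊢ᶜ tNil = _ , ⊑-refl _
  ⊢ₑ⇒⊢ᶜ (tCons {I = I} {J} {B} d d') = I , J , B , ⊢ₑ⇒⊢ᶜ d , ⊢ₑ⇒⊢ᶜ d' , ⊑-refl _
  ⊢ₑ⇒⊢ᶜ tTT = ⊑-refl _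
  ⊢ₑ⇒⊢ᶜ tFF = ⊑-refl _
  ⊢ₑ⇒⊢ᶜ (tSubE {e = e} d Δ⊑Δ' s) = ⊢ᶜ-⊑ e (⊢ᶜ-ctx e Δ⊑Δ' (⊢ₑ⇒⊢ᶜ d)) s

  ⊢ᶜ⇒⊢ₑ : ∀ {Δ : Ctx φ n} e {T} → Φ ⨾ Δ ⊢ᶜ e ∶ T → Φ ⨾ Δ ⊢ₑ e ∶ T
  ⊢ᶜ⇒⊢ₑ {Δ} (var x) (D , eq , s) = tSubE (tVar eq) (CtxSub-refl Δ) s
  ⊢ᶜ⇒⊢ₑ {Δ} zeroE s = tSubE tZero (CtxSub-refl Δ) s
  ⊢ᶜ⇒⊢ₑ {Δ} (sucE e) (I , J , d , s) = tSubE (tSuc (⊢ᶜ⇒⊢ₑ e d)) (CtxSub-refl Δ) s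
  ⊢ᶜ⇒⊢ₑ {Δ} nilE (B , s) = tSubE tNil (CtxSub-refl Δ) s
  ⊢ᶜ⇒⊢ₑ {Δ} (e ∷E e') (I , J , B , d , d' , s) =
    tSubE (tCons (⊢ᶜ⇒⊢ₑ e d) (⊢ᶜ⇒⊢ₑ e' d')) (CtxSub-refl Δ) s
  ⊢ᶜ⇒⊢ₑ {Δ} tt s = tSubE tTT (CtxSub-refl Δ) s
  ⊢ᶜ⇒⊢ₑ {Δ} ff s = tSubE tFF (CtxSub-refl Δ) s

  ⊢ᶜ-var⁻ : ∀ {Δ : Ctx φ n} {e y' D A} → e ≡ var y' → lookup Δ y' ≡ just D →
            Φ ⨾ Δ ⊢ᶜ e ∶ A → Φ ⊢ D ⊑ A
  ⊢ᶜ-var⁻ refl eqD (_ , eq , s) with trans (sym eqD) eq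
  ... | refl = s

  ⊢ᶜ-var-absent : ∀ {Δ : Ctx φ n} {e y' A} → e ≡ var y' → lookup Δ y' ≡ nothing →
                  ¬ (Φ ⨾ Δ ⊢ᶜ e ∶ A)
  ⊢ᶜ-var-absent refl eqD (_ , eq , _) with trans (sym eqD) eq
  ... | ()

  ⊢ᶜ-var-or-base : ∀ {Δ : Ctx φ n} e {T} → Φ ⨾ Δ ⊢ᶜ e ∶ T →
                   (∃ λ x → e ≡ var x) ⊎ (∃ λ B → T ≡ base B)
  ⊢ᶜ-var-or-base (var x) _ = inj₁ (x , refl)
  ⊢ᶜ-var-or-base zeroE s = inj₂ (⊑-baseˡ s)
  ⊢ᶜ-var-or-base (sucE e) (_ , _ , _ , s) = inj₂ (⊑-baseˡ s)
  ⊢ᶜ-var-or-base nilE (_ , s) = inj₂ (⊑-baseˡ s)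
  ⊢ᶜ-var-or-base (e ∷E e') (_ , _ , _ , _ , _ , s) = inj₂ (⊑-baseˡ s)
  ⊢ᶜ-var-or-base tt s = inj₂ (⊑-baseˡ s)
  ⊢ᶜ-var-or-base ff s = inj₂ (⊑-baseˡ s)

  ⊢ᶜ-base-ctx : ∀ {Δ Δ' : Ctx φ n} e {B} → KeepsBase Δ Δ' →
                Φ ⨾ Δ ⊢ᶜ e ∶ base B → Φ ⨾ Δ' ⊢ᶜ e ∶ base B
  ⊢ᶜ-base-ctx (var x) Δ⊆Δ' (D , eq , s) with ⊑-baseʳ s
  ... | _ , refl = D , Δ⊆Δ' x eq , s
  ⊢ᶜ-base-ctx zeroE Δ⊆Δ' s = s
  ⊢ᶜ-base-ctx (sucE e) Δ⊆Δ' (I , J , d , s) = I , J , ⊢ᶜ-base-ctx e Δ⊆Δ' d , s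
  ⊢ᶜ-base-ctx nilE Δ⊆Δ' s = s
  ⊢ᶜ-base-ctx (e ∷E e') Δ⊆Δ' (I , J , B , d , d' , s) =
    I , J , B , ⊢ᶜ-base-ctx e Δ⊆Δ' d , ⊢ᶜ-base-ctx e' Δ⊆Δ' d' , s
  ⊢ᶜ-base-ctx tt Δ⊆Δ' s = s
  ⊢ᶜ-base-ctx ff Δ⊆Δ' s = s

  ⊢ᶜ-adv : ∀ {Δ Δ' : Ctx φ n} {K} e {A A₁} → CtxAdv Φ K Δ Δ' → Adv Φ K A (just A₁) →
           Φ ⨾ Δ ⊢ᶜ e ∶ A → Φ ⨾ Δ' ⊢ᶜ e ∶ A₁
  ⊢ᶜ-adv (var x) Δ→Δ' A→ (D , eq , s) = Adv-⊑ s A→ (CtxAdv-lookup Δ→Δ' x eq)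
  ⊢ᶜ-adv zeroE Δ→Δ' A→ s = base⊑-Adv s A→
  ⊢ᶜ-adv (sucE e) Δ→Δ' A→ (I , J , d , s) = I , J , ⊢ᶜ-adv e Δ→Δ' aBase d , base⊑-Adv s A→
  ⊢ᶜ-adv nilE Δ→Δ' A→ (B , s) = B , base⊑-Adv s A→
  ⊢ᶜ-adv (e ∷E e') Δ→Δ' A→ (I , J , B , d , d' , s) =
    I , J , B , ⊢ᶜ-adv e Δ→Δ' aBase d , ⊢ᶜ-adv e' Δ→Δ' aBase d' , base⊑-Adv s A→
  ⊢ᶜ-adv tt Δ→Δ' A→ s = base⊑-Adv s A→
  ⊢ᶜ-adv ff Δ→Δ' A→ s = base⊑-Adv s A→

  ⊢ᶜ-⊨* : ∀ {Φ' : List (Cstr φ)} {Δ : Ctx φ n} e {T} → Φ' ⊨* Φ → Φ ⨾ Δ ⊢ᶜ e ∶ T → Φ' ⨾ Δ ⊢ᶜ e ∶ T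
  ⊢ᶜ-⊨* (var x) Φ'⊨Φ (D , eq , s) = D , eq , ⊑-⊨* Φ'⊨Φ s
  ⊢ᶜ-⊨* zeroE Φ'⊨Φ s = ⊑-⊨* Φ'⊨Φ s
  ⊢ᶜ-⊨* (sucE e) Φ'⊨Φ (I , J , d , s) = I , J , ⊢ᶜ-⊨* e Φ'⊨Φ d , ⊑-⊨* Φ'⊨Φ s
  ⊢ᶜ-⊨* nilE Φ'⊨Φ (B , s) = B , ⊑-⊨* Φ'⊨Φ s
  ⊢ᶜ-⊨* (e ∷E e') Φ'⊨Φ (I , J , B , d , d' , s) =
    I , J , B , ⊢ᶜ-⊨* e Φ'⊨Φ d , ⊢ᶜ-⊨* e' Φ'⊨Φ d' , ⊑-⊨* Φ'⊨Φ s
  ⊢ᶜ-⊨* tt Φ'⊨Φ s = ⊑-⊨* Φ'⊨Φ s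
  ⊢ᶜ-⊨* ff Φ'⊨Φ s = ⊑-⊨* Φ'⊨Φ s

  ⊑-iwk : ∀ m {A B} → Φ ⊢ A ⊑ B → cwk m Φ ⊢ tsub (iwkσ m) A ⊑ tsub (iwkσ m) B
  ⊑-iwk m = ⊑-tsub (iwkσ m) (cwk-⊨⟨iwk⟩ m Φ)

  ⊢ᶜ-wk : ∀ m {Δ : Ctx φ n} e {T} → Φ ⨾ Δ ⊢ᶜ e ∶ T →
          cwk m Φ ⨾ wkCtx m Δ ⊢ᶜ e ∶ tsub (iwkσ m) T
  ⊢ᶜ-wk m {Δ} (var x) (D , eq , s) =
    tsub (iwkσ m) D , trans (VecP.lookup-map x _ Δ) (cong (Maybe.map (tsub (iwkσ m))) eq) ,
    ⊑-iwk m s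
  ⊢ᶜ-wk m zeroE s = ⊑-iwk m s
  ⊢ᶜ-wk m (sucE e) (I , J , d , s) = _ , _ , ⊢ᶜ-wk m e d , ⊑-iwk m s
  ⊢ᶜ-wk m nilE (B , s) = _ , ⊑-iwk m s
  ⊢ᶜ-wk m (e ∷E e') (I , J , B , d , d' , s) =
    _ , _ , _ , ⊢ᶜ-wk m e d , ⊢ᶜ-wk m e' d' , ⊑-iwk m s
  ⊢ᶜ-wk m tt s = ⊑-iwk m s
  ⊢ᶜ-wk m ff s = ⊑-iwk m s

SubstTyped : ∀ {φ m n} → List (Cstr φ) → Ctx φ n → (Fin m → Expr n) → Ctx φ m → Set
SubstTyped Φ Δ σ Γ = ∀ y {A} → lookup Γ y ≡ just A → Φ ⨾ Δ ⊢ᶜ σ y ∶ A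

⊢ᶜ-esub : ∀ {φ m n} {Φ : List (Cstr φ)} {Γ : Ctx φ m} {Δ : Ctx φ n} {σ : Fin m → Expr n} →
          SubstTyped Φ Δ σ Γ → ∀ e {T} → Φ ⨾ Γ ⊢ᶜ e ∶ T → Φ ⨾ Δ ⊢ᶜ esub σ e ∶ T
⊢ᶜ-esub {σ = σ} σ∶Γ (var x) (D , eq , s) = ⊢ᶜ-⊑ (σ x) (σ∶Γ x eq) s
⊢ᶜ-esub σ∶Γ zeroE s = s
⊢ᶜ-esub σ∶Γ (sucE e) (I , J , d , s) = I , J , ⊢ᶜ-esub σ∶Γ e d , s
⊢ᶜ-esub σ∶Γ nilE s = s
⊢ᶜ-esub σ∶Γ (e ∷E e') (I , J , B , d , d' , s) = I , J , B , ⊢ᶜ-esub σ∶Γ e d , ⊢ᶜ-esub σ∶Γ e' d' , s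
⊢ᶜ-esub σ∶Γ tt s = s
⊢ᶜ-esub σ∶Γ ff s = s

-- A well-typed expression is a variable or has base type, and base-typed expressions
-- only look at base-typed hypotheses.
⊢ᶜ-transfer : ∀ {φ n} {Φ : List (Cstr φ)} {Δ Δ' : Ctx φ n} e {A A'} → Φ ⨾ Δ ⊢ᶜ e ∶ A →
              (∀ {x} → e ≡ var x → Φ ⨾ Δ' ⊢ᶜ var x ∶ A') →
              (∀ {B} → A ≡ base B → Φ ⊢ A ⊑ A') → KeepsBase Δ Δ' → Φ ⨾ Δ' ⊢ᶜ e ∶ A'
⊢ᶜ-transfer e d var-typed base-⊑ keeps-base with ⊢ᶜ-var-or-base e d
... | inj₁ (x , refl) = var-typed refl
... | inj₂ (B , refl) with ⊑-baseˡ (base-⊑ refl)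
...   | _ , refl = ⊢ᶜ-base-ctx e keeps-base (⊢ᶜ-⊑ e d (base-⊑ refl))

⊢ᶜ-iserv-var : ∀ {φ n} {Φ : List (Cstr φ)} {Δ : Ctx φ n} e {I m K Ts} →
               Φ ⨾ Δ ⊢ᶜ e ∶ iserv I m K Ts → ∃ λ x → e ≡ var x
⊢ᶜ-iserv-var e d with ⊢ᶜ-var-or-base e d
... | inj₁ is-var = is-var
... | inj₂ (_ , ())

-- Well-typed substitutions

data Origin {φ m n} (σ : Fin m → Expr n) (Γ : Ctx φ m) (y' : Fin n) (D : Type φ) : Set where
  origin : ∀ y {A} → σ y ≡ var y' → lookup Γ y ≡ just A → Tracks D A → Origin σ Γ y' D

record WtSubst {φ m n} (Φ : List (Cstr φ)) (σ : Fin m → Expr n) (Γ : Ctx φ m) (Δ : Ctx φ n) :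
               Set where
  field
    typed  : SubstTyped Φ Δ σ Γ
    covers : ∀ y' {D} → lookup Δ y' ≡ just D → Stable D ⊎ Origin σ Γ y' D
open WtSubst

WtSubst-σ₀ : ∀ {φ n} {Φ : List (Cstr φ)} {Γ : Ctx φ n} {T e} → Φ ⨾ Γ ⊢ₑ e ∶ T →
             WtSubst Φ (σ₀ e) (just T ∷ Γ) Γ
WtSubst-σ₀ e∶T .typed zero refl = ⊢ₑ⇒⊢ᶜ e∶T
WtSubst-σ₀ e∶T .typed (suc x) {A} eq = A , eq , ⊑-refl A
WtSubst-σ₀ e∶T .covers y' {D} eq = inj₂ (origin (suc y') refl eq (Tracks-refl D))

WtSubst-⊨* : ∀ {φ m n} {Φ Φ' : List (Cstr φ)} {σ : Fin m → Expr n} {Γ Δ} → Φ' ⊨* Φ →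
             WtSubst Φ σ Γ Δ → WtSubst Φ' σ Γ Δ
WtSubst-⊨* {σ = σ} Φ'⊨Φ σ∶ .typed y eq = ⊢ᶜ-⊨* (σ y) Φ'⊨Φ (σ∶ .typed y eq)
WtSubst-⊨* Φ'⊨Φ σ∶ .covers = σ∶ .covers

module _ {φ m n k : ℕ} {Φ : List (Cstr φ)} {σ : Fin m → Expr n} {Γ : Ctx φ m} {Δ : Ctx φ n}
         (Bs : Ctx φ k) (σ∶ : WtSubst Φ σ Γ Δ) where

  private
    lookup-binder : ∀ j → lookup (Bs ++ Γ) (j ↑ˡ m) ≡ lookup (Bs ++ Δ) (j ↑ˡ n)
    lookup-binder j = trans (VecP.lookup-++ˡ Bs Γ j) (sym (VecP.lookup-++ˡ Bs Δ j))

    shift∶ : SubstTyped Φ (Bs ++ Δ) (var ∘ (k ↑ʳ_)) Δ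
    shift∶ y {A} eq = A , trans (VecP.lookup-++ʳ Bs Δ y) eq , ⊑-refl A

  WtSubst-bind : WtSubst Φ (elift k σ) (Bs ++ Γ) (Bs ++ Δ)
  WtSubst-bind .typed y eq with split++ k m y
  ... | inˡ j rewrite elift-↑ˡ k σ j = _ , trans (sym (lookup-binder j)) eq , ⊑-refl _
  ... | inʳ i rewrite elift-↑ʳ k σ i =
    ⊢ᶜ-esub shift∶ (σ i) (σ∶ .typed i (trans (sym (VecP.lookup-++ʳ Bs Γ i)) eq))
  WtSubst-bind .covers y' {D} eq with split++ k n y'
  ... | inˡ j = inj₂ (origin (j ↑ˡ m) (elift-↑ˡ k σ j) (trans (lookup-binder j) eq) (Tracks-refl D))
  ... | inʳ i with σ∶ .covers i (trans (sym (VecP.lookup-++ʳ Bs Δ i)) eq)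
  ...   | inj₁ stable = inj₁ stable
  ...   | inj₂ (origin y σy≡i eqA t) =
    inj₂ (origin (k ↑ʳ y) (trans (elift-↑ʳ k σ y) (cong (esub (var ∘ (k ↑ʳ_))) σy≡i))
                 (trans (VecP.lookup-++ʳ Bs Γ y) eqA) t)

wkCtx-lookup⁻ : ∀ {φ n} m (Γ : Ctx φ n) y {A'} → lookup (wkCtx m Γ) y ≡ just A' →
                ∃ λ A → lookup Γ y ≡ just A × A' ≡ tsub (iwkσ m) A
wkCtx-lookup⁻ m Γ y eq with lookup Γ y | VecP.lookup-map y (Maybe.map (tsub (iwkσ m))) Γ
... | just A | eq' = A , refl , just-injective (trans (sym eq) eq')
... | nothing | eq' with trans (sym eq) eq'
...   | ()

WtSubst-wk : ∀ {φ m n} {Φ : List (Cstr φ)} {σ : Fin m → Expr n} {Γ Δ} k →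
             WtSubst Φ σ Γ Δ → WtSubst (cwk k Φ) σ (wkCtx k Γ) (wkCtx k Δ)
WtSubst-wk {σ = σ} {Γ} k σ∶ .typed y eq with wkCtx-lookup⁻ k Γ y eq
... | A , eqA , refl = ⊢ᶜ-wk k (σ y) (σ∶ .typed y eqA)
WtSubst-wk {σ = σ} {Γ} {Δ} k σ∶ .covers y' eq with wkCtx-lookup⁻ k Δ y' eq
... | D , eqD , refl with σ∶ .covers y' eqD
...   | inj₁ stable = inj₁ (Stable-tsub (iwkσ k) D stable)
...   | inj₂ (origin y {A} σy≡y' eqA t) =
  inj₂ (origin y σy≡y' (trans (VecP.lookup-map y _ Γ) (cong (Maybe.map (tsub (iwkσ k))) eqA))
               (Tracks-tsub (iwkσ k) D A t))

module _ {φ m n : ℕ} {Φ : List (Cstr φ)} {σ : Fin m → Expr n} {Γ Γ' : Ctx φ m} {Δ : Ctx φ n}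
         {K : Idx φ} (σ∶ : WtSubst Φ σ Γ Δ) (Γ→Γ' : CtxAdv Φ K Γ Γ') where

  private
    advance : ∀ y' → ∃ (AdvM Φ K (lookup Δ y'))
    advance y' with lookup Δ y' in eqD
    ... | nothing = nothing , nothing
    ... | just D with σ∶ .covers y' eqD
    ...   | inj₁ stable = _ , just (proj₂ (Stable-Adv stable))
    ...   | inj₂ (origin y σy≡y' eqA t) =
      _ , just (proj₂ (Adv-along-Head t (⊑⇒Head (⊢ᶜ-var⁻ σy≡y' eqD (σ∶ .typed y eqA)))
                                          (CtxAdv-lookup Γ→Γ' y eqA)))

    Δ' : Ctx φ n
    Δ' = Vec.tabulate (proj₁ ∘ advance)

    Δ→Δ' : CtxAdv Φ K Δ Δ'
    Δ→Δ' = VPointwise-tabulateʳ Δ (proj₂ ∘ advance)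

    σ∶' : WtSubst Φ σ Γ' Δ'
    σ∶' .typed y eq with CtxAdv-lookup⁻ Γ→Γ' y eq
    ... | A , eqA , A→ = ⊢ᶜ-adv (σ y) Δ→Δ' A→ (σ∶ .typed y eqA)
    σ∶' .covers y' eq with CtxAdv-lookup⁻ Δ→Δ' y' eq
    ... | D , eqD , D→ with σ∶ .covers y' eqD
    ...   | inj₁ stable = inj₁ (Adv-Stable stable D→)
    ...   | inj₂ (origin y σy≡y' eqA t)
            with Adv-Tracks t (⊑⇒Head (⊢ᶜ-var⁻ σy≡y' eqD (σ∶ .typed y eqA)))
                              (CtxAdv-lookup Γ→Γ' y eqA) D→
    ...     | inj₁ (A₁ , eqA₁ , t₁) = inj₂ (origin y σy≡y' eqA₁ t₁)
    ...     | inj₂ stable = inj₁ stable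

  WtSubst-adv : ∃ λ Δ' → CtxAdv Φ K Δ Δ' × WtSubst Φ σ Γ' Δ'
  WtSubst-adv = Δ' , Δ→Δ' , σ∶'

data OServView {φ} : Type φ → Set where
  is-oserv  : ∀ {I m K Ts} → OServView (oserv I m K Ts)
  not-oserv : ∀ {A} → kind A ≢ oservᴷ → OServView A

oservView : ∀ {φ} (A : Type φ) → OServView A
oservView (base _) = not-oserv λ ()
oservView (ch _ _) = not-oserv λ ()
oservView (inT _ _) = not-oserv λ ()
oservView (outT _ _) = not-oserv λ ()
oservView (serv _ _ _ _) = not-oserv λ ()
oservView (iserv _ _ _ _) = not-oserv λ ()
oservView (oserv _ _ _ _) = is-oserv

non-oserv? : ∀ {φ} (x : Maybe (Type φ)) → Dec (∃ λ A → x ≡ just A × kind A ≢ oservᴷ)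
non-oserv? nothing = no λ ()
non-oserv? (just A) with oservView A
... | is-oserv = no λ { (_ , refl , A≢oserv) → A≢oserv refl }
... | not-oserv A≢oserv = yes (A , refl , A≢oserv)

module _ {φ m n : ℕ} {Φ : List (Cstr φ)} {σ : Fin m → Expr n} {Γ Γ₂ : Ctx φ m} {Δ : Ctx φ n}
         (σ∶ : WtSubst Φ σ Γ Δ) (Γ⊑Γ₂ : CtxSub Φ Γ Γ₂) where

  private
    image-⊑ : ∀ {y y' D A₂} → σ y ≡ var y' → lookup Δ y' ≡ just D → lookup Γ₂ y ≡ just A₂ →
              Φ ⊢ D ⊑ A₂
    image-⊑ {y} σy≡y' eqD eq₂ with CtxSub-lookup⁻ Γ⊑Γ₂ y eq₂
    ... | A , eqA , A⊑A₂ = sTrans (⊢ᶜ-var⁻ σy≡y' eqD (σ∶ .typed y eqA)) A⊑A₂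

    record Widened (y' : Fin n) (x : Maybe (Type φ)) : Set where
      field
        entry        : Maybe (Type φ)
        ⊑entry       : MaybeRel (Φ ⊢_⊑_) x entry
        keeps-base   : ∀ {B} → x ≡ just (base B) → entry ≡ just (base B)
        types-images : ∀ y {A₂} → σ y ≡ var y' → lookup Γ₂ y ≡ just A₂ →
                       ∃ λ D₂ → entry ≡ just D₂ × Φ ⊢ D₂ ⊑ A₂
        covers-entry : ∀ {D₂} → entry ≡ just D₂ → Stable D₂ ⊎ Origin σ Γ₂ y' D₂
    open Widened

    undeclared : ∀ {y'} → lookup Δ y' ≡ nothing → Widened y' nothing
    undeclared eqD = record
      { entry = nothing ; ⊑entry = nothing ; keeps-base = λ () ; covers-entry = λ ()
      ; types-images = λ y σy≡y' eq₂ → ⊥-elim (no-image y σy≡y' eq₂) }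
      where
      no-image : ∀ y {A₂} → σ y ≡ var _ → lookup Γ₂ y ≡ just A₂ → ⊥
      no-image y σy≡y' eq₂ with CtxSub-lookup⁻ Γ⊑Γ₂ y eq₂
      ... | A , eqA , _ = ⊢ᶜ-var-absent σy≡y' eqD (σ∶ .typed y eqA)

    kept : ∀ {y' D} → lookup Δ y' ≡ just D → Stable D ⊎ Origin σ Γ₂ y' D → Widened y' (just D)
    kept {D = D} eqD cover = record
      { entry = just D ; ⊑entry = just (⊑-refl D) ; keeps-base = id
      ; types-images = λ y σy≡y' eq₂ → D , refl , image-⊑ σy≡y' eqD eq₂
      ; covers-entry = λ { refl → cover } }

    kept-nonserv : ∀ {y' D} → lookup Δ y' ≡ just D → kind D ≢ servᴷ → Widened y' (just D)
    kept-nonserv {y'} eqD D≢serv with σ∶ .covers y' eqD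
    ... | inj₁ stable = kept eqD (inj₁ stable)
    ... | inj₂ (origin y σy≡y' eqA _) with CtxSub-lookup Γ⊑Γ₂ y eqA
    ...   | _ , eq₂ , _ = kept eqD (inj₂ (origin y σy≡y' eq₂ (⊥-elim ∘ D≢serv)))

    -- A server is kept if some hypothesis of Γ₂ uses it other than through its output view,
    -- and is weakened to that view otherwise.
    server : ∀ {y' I k K Ts} → lookup Δ y' ≡ just (serv I k K Ts) →
             Widened y' (just (serv I k K Ts))
    server {y'} {I} {k} {K} {Ts} eqD
      with FinP.any? (λ y → (σ y ≟var y') ×-dec non-oserv? (lookup Γ₂ y))
    ... | yes (y , σy≡y' , A₂ , eq₂ , A₂≢oserv) =
      kept eqD (inj₂ (origin y σy≡y' eq₂ (λ _ → A₂≢oserv)))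
    ... | no unused = record
      { entry = just (oserv I k K Ts) ; ⊑entry = just sServO ; keeps-base = λ ()
      ; types-images = oserv-images ; covers-entry = λ { refl → inj₁ tt } }
      where
      oserv-images : ∀ y {A₂} → σ y ≡ var y' → lookup Γ₂ y ≡ just A₂ →
                     ∃ λ D₂ → just (oserv I k K Ts) ≡ just D₂ × Φ ⊢ D₂ ⊑ A₂
      oserv-images y {A₂} σy≡y' eq₂ with oservView A₂
      ... | not-oserv A₂≢oserv = ⊥-elim (unused (y , σy≡y' , A₂ , eq₂ , A₂≢oserv))
      ... | is-oserv = _ , refl , ⊑-oview (image-⊑ σy≡y' eqD eq₂) isOServ

    widen : ∀ y' → Widened y' (lookup Δ y')
    widen y' with lookup Δ y' in eqD
    ... | nothing = undeclared eqD
    ... | just (base _) = kept-nonserv eqD λ ()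
    ... | just (ch _ _) = kept-nonserv eqD λ ()
    ... | just (inT _ _) = kept-nonserv eqD λ ()
    ... | just (outT _ _) = kept-nonserv eqD λ ()
    ... | just (serv _ _ _ _) = server eqD
    ... | just (iserv _ _ _ _) = kept-nonserv eqD λ ()
    ... | just (oserv _ _ _ _) = kept-nonserv eqD λ ()

    Δ₂ : Ctx φ n
    Δ₂ = Vec.tabulate (entry ∘ widen)

    lookup-Δ₂ : ∀ y' → lookup Δ₂ y' ≡ widen y' .entry
    lookup-Δ₂ = VecP.lookup∘tabulate (entry ∘ widen)

    σ∶₂ : WtSubst Φ σ Γ₂ Δ₂
    σ∶₂ .typed y eq₂ with CtxSub-lookup⁻ Γ⊑Γ₂ y eq₂
    ... | A , eqA , A⊑A₂ =
      ⊢ᶜ-transfer (σ y) (σ∶ .typed y eqA) image-typed (λ _ → A⊑A₂)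
                  (λ y' eqB → trans (lookup-Δ₂ y') (widen y' .keeps-base eqB))
      where
      image-typed : ∀ {x} → σ y ≡ var x → Φ ⨾ Δ₂ ⊢ᶜ var x ∶ _
      image-typed {x} σy≡x with widen x .types-images y σy≡x eq₂
      ... | D₂ , eq , s = D₂ , trans (lookup-Δ₂ x) eq , s
    σ∶₂ .covers y' eq = widen y' .covers-entry (trans (sym (lookup-Δ₂ y')) eq)

  WtSubst-ctx : ∃ λ Δ₂ → CtxSub Φ Δ Δ₂ × WtSubst Φ σ Γ₂ Δ₂
  WtSubst-ctx = Δ₂ , VPointwise-tabulateʳ Δ (⊑entry ∘ widen) , σ∶₂

-- Replicated input

is-just? : ∀ {A : Set} (x : Maybe A) → Dec (∃ λ a → x ≡ just a)
is-just? nothing = no λ ()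
is-just? (just a) = yes (a , refl)

TI-oview-retime : ∀ {φ} {Φ : List (Cstr φ)} {K D J m L Ts} → OServable D →
                  Φ ⊢ oview (retime K D) ⊑ oserv J m L Ts → Φ ⊨ (J =c ‵ 0) →
                  TI Φ (just (oview (retime K D)))
TI-oview-retime isServ s J=0 with ⊑⇒Head s
... | oserv-oserv p = tiOS (⊩-zipWith trans p J=0)
TI-oview-retime isOServ s J=0 with ⊑⇒Head s
... | oserv-oserv p = tiOS (⊩-zipWith trans p J=0)

module Replication
  {φ m n : ℕ} {Φ : List (Cstr φ)} {σ : Fin m → Expr n} {Γ : Ctx φ m} {Δ : Ctx φ n}
  (σ∶ : WtSubst Φ σ Γ Δ) {I : Idx φ} {k K Ts} (Γ₀ Γ₁ Γ' : Ctx φ m)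
  (Γ₀⊆Γ : SubCtx Γ₀ Γ) (Γ₀→Γ₁ : CtxAdv Φ I Γ₀ Γ₁) (Γ₁⊑Γ' : CtxSub Φ Γ₁ Γ') (Γ'-inv : TimeInv Φ Γ')
  (ya : Fin n) {Da : Type φ} (eqa : lookup Δ ya ≡ just Da) (Da⊑ : Φ ⊢ Da ⊑ iserv I k K Ts) where

  source : ∀ y {A'} → lookup Γ' y ≡ just A' →
           ∃ λ A → ∃ λ A₁ → lookup Γ y ≡ just A × Adv Φ I A (just A₁) × Φ ⊢ A₁ ⊑ A'
  source y eq' with CtxSub-lookup⁻ Γ₁⊑Γ' y eq'
  ... | A₁ , eq₁ , A₁⊑A' with CtxAdv-lookup⁻ Γ₀→Γ₁ y eq₁
  ...   | A , eq₀ , A→A₁ = A , A₁ , SubCtx-lookup Γ₀⊆Γ y eq₀ , A→A₁ , A₁⊑A'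

  data UsedAs : Type φ → Type φ → Set where
    base-use   : ∀ {B A'} → Φ ⊢ base B ⊑ A' → UsedAs (base B) A'
    output-use : ∀ {D A'} → OServable D → Φ ⊢ oview (retime I D) ⊑ A' →
                 TI Φ (just (oview (retime I D))) → UsedAs D A'

  -- Γ' is time invariant, so a used hypothesis is either of base type or a server
  -- used through its output view at time 0.
  used-as : ∀ y {y' A' D} → σ y ≡ var y' → lookup Γ' y ≡ just A' → lookup Δ y' ≡ just D →
            UsedAs D A'
  used-as y {y'} {A'} {D} σy≡y' eq' eqD with source y eq'
  ... | A , A₁ , eqA , A→A₁ , A₁⊑A'
        with ⊢ᶜ-var⁻ σy≡y' eqD (σ∶ .typed y eqA) | VAllP.lookup⁺ Γ'-inv y
  ...   | D⊑A | A'-inv rewrite eq' with A'-inv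
  ...     | tiBase with ⊑-baseʳ A₁⊑A'
  ...       | _ , refl with Adv-base⁻ A→A₁
  ...         | refl with ⊑-baseʳ D⊑A
  ...           | _ , refl = base-use (sTrans D⊑A A₁⊑A')
  used-as y {y'} {A'} {D} σy≡y' eq' eqD | A , A₁ , eqA , A→A₁ , A₁⊑A' | D⊑A | A'-inv | tiOS A'=0
    with Adv-OServable⁻ A→A₁ (Head-OServable⁻ (⊑⇒Head A₁⊑A') isOServ)
  ... | A↑ , oview-A₁ = output-use D↑ D⊑A' (TI-oview-retime D↑ D⊑A' A'=0)
    where
    D↑ = Head-OServable⁻ (⊑⇒Head D⊑A) A↑
    D⊑A' = sTrans (⊑-oview (⊑-retime I D⊑A) (OServable-retime I A↑))
                  (subst (λ X → Φ ⊢ X ⊑ A') oview-A₁ (⊑-oview A₁⊑A' isOServ))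

  Used : Fin n → Set
  Used y' = ∃ λ y → σ y ≡ var y' × ∃ λ A' → lookup Γ' y ≡ just A'

  -- Position y' of the contexts Δ ⊑ Δ₂ ⊇ Δ₀, Δ₁ = Δ₀^{-I} ⊑ Δ' that the replication
  -- rule needs on the side of Δ.
  record RepEntry (y' : Fin n) (x : Maybe (Type φ)) : Set where
    field
      widened kept advanced final : Maybe (Type φ)
      ⊑widened       : MaybeRel (Φ ⊢_⊑_) x widened
      kept⊆widened   : Part kept widened
      kept→advanced  : AdvM Φ I kept advanced
      advanced⊑final : MaybeRel (Φ ⊢_⊑_) advanced final
      final-inv      : TI Φ final
      keeps-base     : ∀ {B} → x ≡ just (base B) → final ≡ just (base B)
      types-images   : ∀ y {A'} → σ y ≡ var y' → lookup Γ' y ≡ just A' →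
                       ∃ λ D' → final ≡ just D' × Φ ⊢ D' ⊑ A'
      subject-kept   : y' ≡ ya → widened ≡ x
      final-stable   : ∀ {D'} → final ≡ just D' → Stable D'
  open RepEntry

  undeclared : ∀ {y'} → lookup Δ y' ≡ nothing → RepEntry y' nothing
  undeclared eqD = record
    { widened = nothing ; kept = nothing ; advanced = nothing ; final = nothing
    ; ⊑widened = nothing ; kept⊆widened = drop ; kept→advanced = nothing ; advanced⊑final = nothing
    ; final-inv = absent ; keeps-base = λ () ; subject-kept = λ _ → refl ; final-stable = λ ()
    ; types-images = λ y σy≡y' eq' → ⊥-elim (no-image y σy≡y' eq') }
    where
    no-image : ∀ y {A'} → σ y ≡ var _ → lookup Γ' y ≡ just A' → ⊥
    no-image y σy≡y' eq' with source y eq'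
    ... | _ , _ , eqA , _ = ⊢ᶜ-var-absent σy≡y' eqD (σ∶ .typed y eqA)

  base-entry : ∀ {y' B} → lookup Δ y' ≡ just (base B) → RepEntry y' (just (base B))
  base-entry {B = B} eqD = record
    { widened = just (base B) ; kept = just (base B)
    ; advanced = just (base B) ; final = just (base B)
    ; ⊑widened = just (⊑-refl _) ; kept⊆widened = keep ; kept→advanced = just aBase
    ; advanced⊑final = just (⊑-refl _) ; final-inv = tiBase ; keeps-base = id
    ; subject-kept = λ _ → refl ; final-stable = λ { refl → tt }
    ; types-images = images }
    where
    images : ∀ y {A'} → σ y ≡ var _ → lookup Γ' y ≡ just A' →
             ∃ λ D' → Maybe.just (base B) ≡ just D' × Φ ⊢ D' ⊑ A'
    images y σy≡y' eq' with used-as y σy≡y' eq' eqD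
    ... | base-use s = _ , refl , s
    ... | output-use () _ _

  module _ {y' : Fin n} {D : Type φ} (eqD : lookup Δ y' ≡ just D) (D≢base : kind D ≢ baseᴷ) where

    not-base : ∀ {B} → Maybe.just D ≢ just (base B)
    not-base = D≢base ∘ cong kind ∘ just-injective

    dropped : ¬ Used y' → RepEntry y' (just D)
    dropped unused = record
      { widened = just D ; kept = nothing ; advanced = nothing ; final = nothing
      ; ⊑widened = just (⊑-refl D) ; kept⊆widened = drop ; kept→advanced = nothing
      ; advanced⊑final = nothing ; final-inv = absent ; keeps-base = ⊥-elim ∘ not-base
      ; subject-kept = λ _ → refl ; final-stable = λ ()
      ; types-images = λ y σy≡y' eq' → ⊥-elim (unused (y , σy≡y' , _ , eq')) }

    output-images : ∀ y {A'} → σ y ≡ var y' → lookup Γ' y ≡ just A' →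
                    ∃ λ D' → Maybe.just (oview (retime I D)) ≡ just D' × Φ ⊢ D' ⊑ A'
    output-images y σy≡y' eq' with used-as y σy≡y' eq' eqD
    ... | base-use _ = ⊥-elim (D≢base refl)
    ... | output-use _ s _ = _ , refl , s

    -- Every used server other than the subject is weakened to its output view, whose
    -- advance needs no decision.
    output : OServable D → TI Φ (just (oview (retime I D))) → y' ≢ ya → RepEntry y' (just D)
    output D↑ inv y'≢ya = record
      { widened = just (oview D) ; kept = just (oview D)
      ; advanced = just (oview (retime I D)) ; final = just (oview (retime I D))
      ; ⊑widened = just (⊑oview D↑) ; kept⊆widened = keep ; kept→advanced = just (oview-Adv D↑)
      ; advanced⊑final = just (⊑-refl _) ; final-inv = inv
      ; keeps-base = ⊥-elim ∘ not-base
      ; types-images = output-images ; subject-kept = ⊥-elim ∘ y'≢ya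
      ; final-stable = λ { refl → oview-Stable D↑ } }
      where
      oview-Adv : ∀ {D} → OServable D → Adv Φ I (oview D) (just (oview (retime I D)))
      oview-Adv isServ = aOServ
      oview-Adv isOServ = aOServ
      oview-Stable : ∀ {D} → OServable D → Stable (oview (retime I D))
      oview-Stable isServ = tt
      oview-Stable isOServ = tt

    -- The subject is a server at time I, so it advances to a server at time 0.
    subject : OServable D → TI Φ (just (oview (retime I D))) → y' ≡ ya → RepEntry y' (just D)
    subject D↑ inv refl with trans (sym eqD) eqa
    ... | refl with ⊑⇒Head Da⊑ | D↑
    ...   | serv-iserv {I = J} J=I | isServ = record
      { widened = just D ; kept = just D
      ; advanced = just (retime I D) ; final = just (oview (retime I D))
      ; ⊑widened = just (⊑-refl D) ; kept⊆widened = keep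
      ; kept→advanced = just (aServ (⊩-map (λ J=I → ℕP.≤-reflexive (sym J=I)) J=I))
      ; advanced⊑final = just sServO ; final-inv = inv
      ; keeps-base = ⊥-elim ∘ not-base
      ; types-images = output-images ; subject-kept = λ _ → refl ; final-stable = λ { refl → tt } }

    nonbase-entry : RepEntry y' (just D)
    nonbase-entry with FinP.any? (λ y → (σ y ≟var y') ×-dec is-just? (lookup Γ' y))
    ... | no unused = dropped unused
    ... | yes (y , σy≡y' , _ , eq') with used-as y σy≡y' eq' eqD
    ...   | base-use _ = ⊥-elim (D≢base refl)
    ...   | output-use D↑ _ inv with y' Fin.≟ ya
    ...     | no y'≢ya = output D↑ inv y'≢ya
    ...     | yes y'≡ya = subject D↑ inv y'≡ya

  entry : ∀ y' → RepEntry y' (lookup Δ y')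
  entry y' with lookup Δ y' in eqD
  ... | nothing = undeclared eqD
  ... | just (base _) = base-entry eqD
  ... | just (ch _ _) = nonbase-entry eqD λ ()
  ... | just (inT _ _) = nonbase-entry eqD λ ()
  ... | just (outT _ _) = nonbase-entry eqD λ ()
  ... | just (serv _ _ _ _) = nonbase-entry eqD λ ()
  ... | just (iserv _ _ _ _) = nonbase-entry eqD λ ()
  ... | just (oserv _ _ _ _) = nonbase-entry eqD λ ()

  Δ₂ Δ₀ Δ₁ Δ' : Ctx φ n
  Δ₂ = Vec.tabulate (widened ∘ entry)
  Δ₀ = Vec.tabulate (kept ∘ entry)
  Δ₁ = Vec.tabulate (advanced ∘ entry)
  Δ' = Vec.tabulate (final ∘ entry)

  Δ⊑Δ₂ : CtxSub Φ Δ Δ₂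
  Δ⊑Δ₂ = VPointwise-tabulateʳ Δ (⊑widened ∘ entry)

  Δ₀⊆Δ₂ : SubCtx Δ₀ Δ₂
  Δ₀⊆Δ₂ = VPW.tabulate⁺ (kept⊆widened ∘ entry)

  Δ₀→Δ₁ : CtxAdv Φ I Δ₀ Δ₁
  Δ₀→Δ₁ = VPW.tabulate⁺ (kept→advanced ∘ entry)

  Δ₁⊑Δ' : CtxSub Φ Δ₁ Δ'
  Δ₁⊑Δ' = VPW.tabulate⁺ (advanced⊑final ∘ entry)

  Δ'-inv : TimeInv Φ Δ'
  Δ'-inv = VAllP.tabulate⁺ (final-inv ∘ entry)

  lookup-Δ' : ∀ y' → lookup Δ' y' ≡ entry y' .final
  lookup-Δ' = VecP.lookup∘tabulate (final ∘ entry)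

  subject∶ : Φ ⨾ Δ₂ ⊢ₑ var ya ∶ iserv I k K Ts
  subject∶ = ⊢ᶜ⇒⊢ₑ (var ya)
    (Da , trans (VecP.lookup∘tabulate (widened ∘ entry) ya) (trans (entry ya .subject-kept refl) eqa) ,
     Da⊑)

  σ∶' : WtSubst Φ σ Γ' Δ'
  σ∶' .typed y {A'} eq' with source y eq'
  ... | A , A₁ , eqA , A→A₁ , A₁⊑A' =
    ⊢ᶜ-transfer (σ y) (σ∶ .typed y eqA) image-typed base-⊑
                (λ y' eqB → trans (lookup-Δ' y') (entry y' .keeps-base eqB))
    where
    image-typed : ∀ {x} → σ y ≡ var x → Φ ⨾ Δ' ⊢ᶜ var x ∶ A'
    image-typed {x} σy≡x with entry x .types-images y σy≡x eq'
    ... | D' , eq , s = D' , trans (lookup-Δ' x) eq , s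
    base-⊑ : ∀ {B} → A ≡ base B → Φ ⊢ A ⊑ A'
    base-⊑ refl rewrite Adv-base A→A₁ = A₁⊑A'
  σ∶' .covers y' eq = inj₁ (entry y' .final-stable (trans (sym (lookup-Δ' y')) eq))

-- The substitution lemma

⊢ₑ-esub : ∀ {φ m n} {Φ : List (Cstr φ)} {σ : Fin m → Expr n} {Γ Δ} → WtSubst Φ σ Γ Δ →
          ∀ {e T} → Φ ⨾ Γ ⊢ₑ e ∶ T → Φ ⨾ Δ ⊢ₑ esub σ e ∶ T
⊢ₑ-esub {σ = σ} σ∶ {e} d = ⊢ᶜ⇒⊢ₑ (esub σ e) (⊢ᶜ-esub (σ∶ .typed) e (⊢ₑ⇒⊢ᶜ d))

⊢ₑ*-esub : ∀ {φ m n} {Φ : List (Cstr φ)} {σ : Fin m → Expr n} {Γ Δ} → WtSubst Φ σ Γ Δ →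
           ∀ {es Ts} → Pointwise (λ e T → Φ ⨾ Γ ⊢ₑ e ∶ T) es Ts →
           Pointwise (λ e T → Φ ⨾ Δ ⊢ₑ e ∶ T) (List.map (esub σ) es) Ts
⊢ₑ*-esub σ∶ [] = []
⊢ₑ*-esub σ∶ (d ∷ ds) = ⊢ₑ-esub σ∶ d ∷ ⊢ₑ*-esub σ∶ ds

⊢-psub : ∀ {φ m n} {Φ : List (Cstr φ)} {σ : Fin m → Expr n} {Γ Δ} → WtSubst Φ σ Γ Δ →
         ∀ {P K} → Φ ⨾ Γ ⊢ P ◁ K → Φ ⨾ Δ ⊢ psub σ P ◁ K
⊢-psub σ∶ tNil = tNil
⊢-psub σ∶ (tPar dP dQ) = tPar (⊢-psub σ∶ dP) (⊢-psub σ∶ dQ)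
⊢-psub {σ = σ} σ∶ (tRep {a = a} {I = I} {m = m} {Ts = Ts} Γ₀ Γ₁ Γ' da Γ₀⊆Γ Γ₀→Γ₁ Γ₁⊑Γ' Γ'-inv dP)
  with esub σ a | ⊢ᶜ-esub (σ∶ .typed) a (⊢ₑ⇒⊢ᶜ da)
... | a' | da' with ⊢ᶜ-iserv-var a' da'
...   | ya , refl with da'
...     | Da , eqa , Da⊑ =
  tSubP (tRep R.Δ₀ R.Δ₁ R.Δ' R.subject∶ R.Δ₀⊆Δ₂ R.Δ₀→Δ₁ R.Δ₁⊑Δ' R.Δ'-inv
              (⊢-psub (WtSubst-bind (binders Ts) (WtSubst-wk m R.σ∶')) dP))
        R.Δ⊑Δ₂ (⊩-pure ℕP.≤-refl)
  where module R = Replication σ∶ Γ₀ Γ₁ Γ' Γ₀⊆Γ Γ₀→Γ₁ Γ₁⊑Γ' Γ'-inv ya eqa Da⊑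
⊢-psub σ∶ (tIn {Ts = Ts} Γ' da Γ→Γ' dP) with WtSubst-adv σ∶ Γ→Γ'
... | Δ' , Δ→Δ' , σ∶' = tIn Δ' (⊢ₑ-esub σ∶ da) Δ→Δ' (⊢-psub (WtSubst-bind (binders Ts) σ∶') dP)
⊢-psub σ∶ (tOut Γ' da Γ→Γ' des) with WtSubst-adv σ∶ Γ→Γ'
... | Δ' , Δ→Δ' , σ∶' = tOut Δ' (⊢ₑ-esub σ∶ da) Δ→Δ' (⊢ₑ*-esub σ∶' des)
⊢-psub σ∶ (tOutS Γ' Js da Γ→Γ' des) with WtSubst-adv σ∶ Γ→Γ'
... | Δ' , Δ→Δ' , σ∶' = tOutS Δ' Js (⊢ₑ-esub σ∶ da) Δ→Δ' (⊢ₑ*-esub σ∶' des)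
⊢-psub σ∶ (tNu T dP) = tNu T (⊢-psub (WtSubst-bind (just T ∷ []) σ∶) dP)
⊢-psub σ∶ (tMatchN {I = I} {J} de dP dQ) =
  tMatchN (⊢ₑ-esub σ∶ de) (⊢-psub σ∶₊ dP)
    (⊢-psub (WtSubst-bind (just (base (Nat (I ⊖ ‵ 1) (J ⊖ ‵ 1))) ∷ []) σ∶₊) dQ)
  where σ∶₊ = λ {C} → WtSubst-⊨* (∷-⊨* C) σ∶
⊢-psub σ∶ (tMatchL {I = I} {J} {B} de dP dQ) =
  tMatchL (⊢ₑ-esub σ∶ de) (⊢-psub σ∶₊ dP)
    (⊢-psub (WtSubst-bind (just (base B) ∷ just (base (Lst (I ⊖ ‵ 1) (J ⊖ ‵ 1) B)) ∷ []) σ∶₊) dQ)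
  where σ∶₊ = λ {C} → WtSubst-⊨* (∷-⊨* C) σ∶
⊢-psub σ∶ (tIf de dP dQ) = tIf (⊢ₑ-esub σ∶ de) (⊢-psub σ∶ dP) (⊢-psub σ∶ dQ)
⊢-psub σ∶ (tTick Γ' Γ→Γ' dP) with WtSubst-adv σ∶ Γ→Γ'
... | Δ' , Δ→Δ' , σ∶' = tTick Δ' Δ→Δ' (⊢-psub σ∶' dP)
⊢-psub σ∶ (tSubP dP Γ⊑Γ₂ K≤K') with WtSubst-ctx σ∶ Γ⊑Γ₂
... | Δ₂ , Δ⊑Δ₂ , σ∶₂ = tSubP (⊢-psub σ∶₂ dP) Δ⊑Δ₂ K≤K'

lemma4p5 : ∀ {φ n : ℕ} (Φ : List (Cstr φ)) (Γ : Ctx φ n) (T : Type φ) (e : Expr n) →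
    Φ ⨾ Γ ⊢ₑ e ∶ T →
    ((e' : Expr (suc n)) (U : Type φ) →
       Φ ⨾ (just T ∷ Γ) ⊢ₑ e' ∶ U → Φ ⨾ Γ ⊢ₑ e' [ e ]ₑ ∶ U)
    × ((P : Proc (suc n)) (K : Idx φ) →
       Φ ⨾ (just T ∷ Γ) ⊢ P ◁ K → Φ ⨾ Γ ⊢ P [ e ]ₚ ◁ K)
lemma4p5 Φ Γ T e e∶T =
  (λ e' U → ⊢ₑ-esub (WtSubst-σ₀ e∶T)) , (λ P K → ⊢-psub (WtSubst-σ₀ e∶T))
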